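{- Let $n$ be a power of $2$. Any Sherali–Adams refutation of the binary $\mathrm{PHP}^{n+1}_n$ contains at least $(6/5)^{n/16}-1$ terms.
   Context: Binary $\mathrm{PHP}^m_n$: variables $P_{i,k}$ for pigeon $i\in[m]$ and bit $k\in[\log n]$; writing $P^1=P$, $P^0=\neg P$, and $a_1\dots a_{\log n}$ for the binary representation of hole $a$, the clauses are $\bigvee_{k=1}^{\log n}P_{i,k}^{1-a_k}\vee\bigvee_{k=1}^{\log n}P_{i',k}^{1-a_k}$ for all $a\in[n]$ and $i\neq i'\in[m]$. Sherali–Adams (SA): for a CNF $F$ the SA variables ("terms") are $Z_D$ for $D$ a conjunction of literals of $F$ (commutative, idempotent), with $Z_\emptyset=1$; the constraints are, for conjunctions $D$: $Z_{l_1\wedge D}+\dots+Z_{l_t\wedge D}\ge Z_D$ for each clause $l_1\vee\dots\vee l_t$ of $F$; $Z_{v\wedge D}+Z_{\neg v\wedge D}=Z_D$ for each variable $v$; $0\le Z_{v\wedge D}\le Z_D$ and $0\le Z_{\neg v\wedge D}\le Z_D$. An SA refutation is a set of such constraints whose real solution set is empty; its terms are the variables $Z_D$ occurring in it. -}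

module Defs where

open import Data.Nat using (ℕ; zero; suc; _^_; _/_; _%_; _≡ᵇ_)
open import Data.Bool using (Bool; true; false; not; if_then_else_)
import Data.Bool as B
open import Data.Fin using (Fin; toℕ)
open import Data.List using (List; []; _∷_; _++_; map; foldr; length; deduplicate)
open import Data.List.Relation.Unary.All using (All)
open import Data.Vec using (Vec; replicate; updateAt; allFin)
import Data.Vec as V
import Data.Vec.Properties as VP
import Data.Product.Properties as PP
open import Data.Product using (_×_; _,_; Σ)
open import Data.Rational using (ℚ; 0ℚ; 1ℚ; _+_; _≤_)
open import Relation.Binary.PropositionalEquality using (_≡_; _≢_)
open import Relation.Binary.Definitions using (DecidableEquality)
open import Relation.Nullary using (¬_)

-- Binary PHP^{n+1}_n with n = 2^ℓ (so log n = ℓ).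
Pigeon : ℕ → Set
Pigeon ℓ = Fin (suc (2 ^ ℓ))

Hole : ℕ → Set
Hole ℓ = Fin (2 ^ ℓ)

-- bit k of the binary representation of hole a (holes are 0 … n-1)
-- (k = 0 is the least significant bit; the order of bits is immaterial)
bitℕ : ℕ → ℕ → Bool
bitℕ m zero    = (m % 2) ≡ᵇ 1
bitℕ m (suc k) = bitℕ (m / 2) k

bit : ∀ {ℓ} → Hole ℓ → Fin ℓ → Bool
bit a k = bitℕ (toℕ a) (toℕ k)

-- a literal P_{i,k}^b : pigeon, bit position, polarity (true = P, false = ¬P)
Lit : ℕ → Set
Lit ℓ = Pigeon ℓ × Fin ℓ × Bool

clauseLits : ∀ {ℓ} → Hole ℓ → Pigeon ℓ → Pigeon ℓ → List (Lit ℓ)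
clauseLits {ℓ} a i i' =
  V.toList (V.map (λ k → (i , k , not (bit a k))) (allFin ℓ))
  ++ V.toList (V.map (λ k → (i' , k , not (bit a k))) (allFin ℓ))

-- A conjunction of literals (commutative, idempotent) = a set of literals,
-- represented canonically: for each variable (i,k) a pair
-- (P_{i,k} occurs , ¬P_{i,k} occurs).
Conj : ℕ → Set
Conj ℓ = Vec (Vec (Bool × Bool) ℓ) (suc (2 ^ ℓ))

emptyC : ∀ {ℓ} → Conj ℓ
emptyC {ℓ} = replicate (suc (2 ^ ℓ)) (replicate ℓ (false , false))

_∧C_ : ∀ {ℓ} → Lit ℓ → Conj ℓ → Conj ℓ
(i , k , b) ∧C D = updateAt D i (λ row → updateAt row k
  (λ { (p , q) → if b then (true , q) else (p , true) }))

_≟C_ : ∀ {ℓ} → DecidableEquality (Conj ℓ)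
_≟C_ = VP.≡-dec (VP.≡-dec (PP.≡-dec B._≟_ B._≟_))

data Constraint (ℓ : ℕ) : Set where
  clauseC : (a : Hole ℓ) (i i' : Pigeon ℓ) → i ≢ i' → Conj ℓ → Constraint ℓ
  complC  : Pigeon ℓ → Fin ℓ → Conj ℓ → Constraint ℓ
  boundC  : Lit ℓ → Conj ℓ → Constraint ℓ

sumℚ : List ℚ → ℚ
sumℚ = foldr _+_ 0ℚ

Sat : ∀ {ℓ} → (Conj ℓ → ℚ) → Constraint ℓ → Set
Sat Z (clauseC a i i' _ D) = Z D ≤ sumℚ (map (λ l → Z (l ∧C D)) (clauseLits a i i'))
Sat Z (complC i k D) = Z ((i , k , true) ∧C D) + Z ((i , k , false) ∧C D) ≡ Z D
Sat Z (boundC l D) = (0ℚ ≤ Z (l ∧C D)) × (Z (l ∧C D) ≤ Z D)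

terms : ∀ {ℓ} → Constraint ℓ → List (Conj ℓ)
terms (clauseC a i i' _ D) = D ∷ map (λ l → l ∧C D) (clauseLits a i i')
terms (complC i k D) = D ∷ ((i , k , true) ∧C D) ∷ ((i , k , false) ∧C D) ∷ []
terms (boundC l D) = D ∷ (l ∧C D) ∷ []

numTerms : ∀ {ℓ} → List (Constraint ℓ) → ℕ
numTerms R = length (deduplicate _≟C_ (Data.List.concatMap terms R))

Refutation : ∀ {ℓ} → List (Constraint ℓ) → Set
Refutation {ℓ} R = ¬ (Σ (Conj ℓ → ℚ) λ Z → (Z emptyC ≡ 1ℚ) × All (Sat Z) R)

-- Restrict PHP^{n+1}_n to a copy of PHP^{m+1}_m, m = n/2: pair up the pigeons 1 … n and the holes,
-- the two holes of a pair having complementary bits, and match one pigeon of each pair to one hole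
-- of the pair at random. A term mentioning a pair survives at most 3 of the 4 choices for that pair,
-- since a mentioned row of bits admits at most one of two complementary holes; so with fewer than
-- (4/3)^(m-2) terms some choice falsifies every term mentioning at least m - 2 pairs. Every other
-- term mentions at most m - 2 of the m + 1 free pigeons, and for such terms the probability that a
-- random injection of the free pigeons it mentions into the m available holes satisfies it is a
-- solution of all SA constraints (falsified terms get 0). Hence a refutation has at least
-- (4/3)^(m-2) terms, which exceeds (6/5)^(n/16) - 1; for n ≤ 8 the bound is below 1.

module Submission where

open import Defs
open import Data.Nat
open import Data.Nat.Properties
open import Data.Nat.DivMod
open import Data.Nat.ListAction using () renaming (sum to listSum)
open import Data.Nat.ListAction.Properties using (sum-++)
open import Data.Nat.Tactic.RingSolver using (solve-∀)
open import Data.Bool using (Bool; true; false; not; _∧_; _∨_; if_then_else_; T; T?)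
open import Data.Bool.Properties using (∧-assoc; ∧-comm; ∧-identityʳ; ∧-zeroʳ; ∨-zeroʳ)
open import Data.Bool.ListAction using (all)
open import Data.Bool.Solver using (module ∨-∧-Solver)
open import Data.Fin as F using (Fin; zero; suc; toℕ; fromℕ<; _↑ˡ_; _↑ʳ_; opposite; splitAt)
import Data.Fin.Properties as FP
open import Data.Fin.Permutation using (reverse)
open import Data.Maybe using (Maybe; just; nothing)
open import Data.Maybe.Properties using (just-injective)
open import Data.Vec as V using (Vec; []; _∷_; updateAt)
import Data.Vec.Properties as VP
import Data.Vec.Membership.Propositional.Properties as VMP
open import Data.Vec.Functional using (Vector; foldr; removeAt)
open import Data.List as L using (List; []; _∷_; _++_; length; filter; concatMap; deduplicate)
open import Data.List.Properties using (length-++; ++-assoc; map-++; map-∘; length-filter)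
open import Data.List.Relation.Unary.Any as Any using (here; there)
open import Data.List.Relation.Unary.All as All using (All; []; _∷_)
open import Data.List.Relation.Unary.All.Properties using (all-filter; filter⁻)
open import Data.List.Membership.Propositional using (_∈_)
open import Data.List.Membership.Propositional.Properties using (∈-filter⁺; ∈-deduplicate⁺; ∈-concatMap⁺)
open import Data.Product using (Σ; ∃; ∃₂; _×_; _,_; proj₁; proj₂)
open import Data.Sum using (_⊎_; inj₁; inj₂; [_,_]′)
open import Data.Empty using (⊥; ⊥-elim)
open import Function using (_∘_)
open import Relation.Binary.PropositionalEquality
open import Relation.Nullary using (¬_; Dec; does; yes; no; ¬?)
open import Relation.Nullary.Decidable using (dec-true; dec-false)
open import Data.Rational as ℚ using (ℚ; 0ℚ; 1ℚ; 1/_)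
import Data.Rational.Properties as ℚP
open import Algebra.Properties.Semiring.Sum +-*-semiring
  using (sum; sum-cong-≗; ∑-distrib-+; ∑-comm; *-distribˡ-sum; sum-permute)
open import Algebra.Properties.CommutativeMonoid.Sum *-1-commutativeMonoid
  using () renaming (sum to product; sum-remove to product-remove; sum-cong-≗ to product-cong-≗)
open import Algebra.Properties.CommutativeSemigroup +-commutativeSemigroup
  using () renaming (x∙yz≈y∙xz to +-leftComm; interchange to +-interchange)
open import Algebra.Properties.CommutativeSemigroup *-commutativeSemigroup
  using () renaming (x∙yz≈y∙xz to *-leftComm)
open import Algebra.Properties.Monoid.Mult ℚP.+-0-monoid using (×-homo-+) renaming (_×_ to _·_)

𝟙 : Bool → ℕ
𝟙 true = 1
𝟙 false = 0

𝟙≤1 : ∀ b → 𝟙 b ≤ 1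
𝟙≤1 true = ≤-refl
𝟙≤1 false = z≤n

𝟙-∧ : ∀ a b → 𝟙 (a ∧ b) ≡ 𝟙 a * 𝟙 b
𝟙-∧ true b = sym (+-identityʳ (𝟙 b))
𝟙-∧ false b = refl

𝟙-∨ˡ : ∀ a b → 𝟙 a ≤ 𝟙 (a ∨ b)
𝟙-∨ˡ true b = ≤-refl
𝟙-∨ˡ false b = z≤n

𝟙-∨ʳ : ∀ a b → 𝟙 b ≤ 𝟙 (a ∨ b)
𝟙-∨ʳ true b = 𝟙≤1 b
𝟙-∨ʳ false b = ≤-refl

𝟙-*-cong : ∀ b {x y} → (b ≡ true → x ≡ y) → 𝟙 b * x ≡ 𝟙 b * y
𝟙-*-cong true x≡y = cong (_+ 0) (x≡y refl)
𝟙-*-cong false x≡y = refl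

𝟙-*-zero : ∀ b {x} → (b ≡ true → x ≡ 0) → 𝟙 b * x ≡ 0
𝟙-*-zero b {x} x≡0 = trans (𝟙-*-cong b x≡0) (*-zeroʳ (𝟙 b))

∧-true₁ : ∀ {a b} → a ∧ b ≡ true → a ≡ true
∧-true₁ {true} _ = refl

∧-true₂ : ∀ {a b} → a ∧ b ≡ true → b ≡ true
∧-true₂ {true} b≡true = b≡true

≢true⇒≡false : ∀ {b} → ¬ T b → b ≡ false
≢true⇒≡false {true} ¬Tb = ⊥-elim (¬Tb _)
≢true⇒≡false {false} _ = refl

∧-rearrange : ∀ a b n c → a ∧ ((b ∧ n) ∧ c) ≡ (b ∧ c) ∧ (a ∧ n)
∧-rearrange = solve 4 (λ a b n c → a :* ((b :* n) :* c) := (b :* c) :* (a :* n)) refl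
  where open ∨-∧-Solver

∧-swapʳ : ∀ a b c → (a ∧ b) ∧ c ≡ (a ∧ c) ∧ b
∧-swapʳ = solve 3 (λ a b c → (a :* b) :* c := (a :* c) :* b) refl
  where open ∨-∧-Solver

∧-false-interchange : ∀ a b c d → a ∧ c ≡ false → (a ∧ b) ∧ (c ∧ d) ≡ false
∧-false-interchange true b false d _ = ∧-zeroʳ b
∧-false-interchange false b c d _ = refl

_==_ : Bool → Bool → Bool
true == b = b
false == b = not b

==-refl : ∀ b → (b == b) ≡ true
==-refl true = refl
==-refl false = refl

==⇒≡ : ∀ {a b} → (a == b) ≡ true → a ≡ b
==⇒≡ {true} {true} _ = refl
==⇒≡ {false} {false} _ = refl

sum-zero : ∀ {n} {f : Vector ℕ n} → (∀ i → f i ≡ 0) → sum f ≡ 0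
sum-zero {zero} f≡0 = refl
sum-zero {suc n} f≡0 = cong₂ _+_ (f≡0 zero) (sum-zero (f≡0 ∘ suc))

sum-mono-≤ : ∀ {n} {f g : Vector ℕ n} → (∀ i → f i ≤ g i) → sum f ≤ sum g
sum-mono-≤ {zero} f≤g = z≤n
sum-mono-≤ {suc n} f≤g = +-mono-≤ (f≤g zero) (sum-mono-≤ (f≤g ∘ suc))

sum-ones : ∀ n → sum {n} (λ _ → 1) ≡ n
sum-ones zero = refl
sum-ones (suc n) = cong suc (sum-ones n)

sum-≤-1+ : ∀ {n} (f g : Vector ℕ n) i → (∀ p → p ≢ i → f p ≤ g p) → f i ≤ 1 → sum f ≤ 1 + sum g
sum-≤-1+ f g zero f≤g fi≤1 = +-mono-≤ fi≤1 (+-mono-≤ z≤n (sum-mono-≤ (λ p → f≤g (suc p) λ ())))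
sum-≤-1+ f g (suc i) f≤g fi≤1 = begin
  f zero + sum (f ∘ suc)       ≤⟨ +-mono-≤ (f≤g zero λ ()) (sum-≤-1+ (f ∘ suc) (g ∘ suc) i f≤g′ fi≤1) ⟩
  g zero + (1 + sum (g ∘ suc)) ≡⟨ +-suc (g zero) _ ⟩
  1 + sum g                     ∎
  where
  open ≤-Reasoning
  f≤g′ : ∀ p → p ≢ i → f (suc p) ≤ g (suc p)
  f≤g′ p p≢i = f≤g (suc p) (p≢i ∘ FP.suc-injective)

sum-≤-2+ : ∀ {n} (f g : Vector ℕ n) i j → (∀ p → p ≢ i → p ≢ j → f p ≡ g p) →
  (∀ p → f p ≤ 1) → (∀ p → g p ≤ 1) → sum f ≤ 2 + sum g
sum-≤-2+ f g i j f≡g f≤1 g≤1 = begin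
  sum f             ≤⟨ sum-≤-1+ f h i f≤h (f≤1 i) ⟩
  1 + sum h         ≤⟨ +-monoʳ-≤ 1 (sum-≤-1+ h g j h≤g (h≤1 j)) ⟩
  1 + (1 + sum g)   ∎
  where
  open ≤-Reasoning
  h : Vector ℕ _
  h p = if does (p F.≟ i) then g p else f p
  h≤1 : ∀ p → h p ≤ 1
  h≤1 p with does (p F.≟ i)
  ... | true = g≤1 p
  ... | false = f≤1 p
  f≤h : ∀ p → p ≢ i → f p ≤ h p
  f≤h p p≢i rewrite dec-false (p F.≟ i) p≢i = ≤-refl
  h≤g : ∀ p → p ≢ j → h p ≤ g p
  h≤g p p≢j with p F.≟ i
  ... | yes _ = ≤-refl
  ... | no p≢i = ≤-reflexive (f≡g p p≢i p≢j)

sum-↑ : ∀ m {k} (f : Vector ℕ (m + k)) → sum f ≡ sum (f ∘ (_↑ˡ k)) + sum (f ∘ (m ↑ʳ_))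
sum-↑ zero f = refl
sum-↑ (suc m) f = trans (cong (f zero +_) (sum-↑ m (f ∘ suc))) (sym (+-assoc (f zero) _ _))

sum-cast : ∀ {a b} (a≡b : a ≡ b) (f : Vector ℕ b) → sum f ≡ sum (f ∘ F.cast a≡b)
sum-cast {zero} {zero} _ f = refl
sum-cast {suc a} {suc b} a≡b f = cong (f zero +_) (sum-cast (suc-injective a≡b) (f ∘ suc))

sum-opposite : ∀ {m} (f : Vector ℕ m) → sum (f ∘ opposite) ≡ sum f
sum-opposite f = sym (sum-permute f reverse)

product-agree : ∀ {n} (f g : Vector ℕ (suc n)) i → (∀ p → p ≢ i → f p ≡ g p) →
  product f ≡ f i * product (removeAt g i)
product-agree f g i f≡g = trans (product-remove f)
  (cong (f i *_) (product-cong-≗ (λ p → f≡g (F.punchIn i p) (FP.punchInᵢ≢i i p))))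

product-zero : ∀ {n} (f : Vector ℕ (suc n)) i → f i ≡ 0 → product f ≡ 0
product-zero f i fi≡0 = trans (product-agree f f i (λ _ _ → refl)) (cong (_* product (removeAt f i)) fi≡0)

product-ones : ∀ {n} {f : Vector ℕ n} → (∀ i → f i ≡ 1) → product f ≡ 1
product-ones {zero} f≡1 = refl
product-ones {suc n} f≡1 = cong₂ _*_ (f≡1 zero) (product-ones (f≡1 ∘ suc))

concat : ∀ {n} {A : Set} → Vector (List A) n → List A
concat = foldr _++_ []

length-concat : ∀ {n} {A : Set} (f : Vector (List A) n) → length (concat f) ≡ sum (length ∘ f)
length-concat {zero} f = refl
length-concat {suc n} f = trans (length-++ (f zero)) (cong (length (f zero) +_) (length-concat (f ∘ suc)))

concat-[] : ∀ {n} {A : Set} {f : Vector (List A) n} → (∀ i → f i ≡ []) → concat f ≡ []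
concat-[] {zero} f≡[] = refl
concat-[] {suc n} f≡[] = cong₂ _++_ (f≡[] zero) (concat-[] (f≡[] ∘ suc))

concat-cong : ∀ {n} {A : Set} {f g : Vector (List A) n} → (∀ i → f i ≡ g i) → concat f ≡ concat g
concat-cong {zero} f≡g = refl
concat-cong {suc n} f≡g = cong₂ _++_ (f≡g zero) (concat-cong (f≡g ∘ suc))

concat-around : ∀ {n} {A : Set} (f : Vector (List A) n) i → ∃₂ λ pre post →
  ∀ g → (∀ p → p ≢ i → g p ≡ f p) → concat g ≡ pre ++ g i ++ post
concat-around f zero = [] , concat (f ∘ suc) , λ g g≡f →
  cong (g zero ++_) (concat-cong (λ p → g≡f (suc p) λ ()))
concat-around f (suc i) with concat-around (f ∘ suc) i
... | pre , post , split = f zero ++ pre , post , λ g g≡f → begin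
  g zero ++ concat (g ∘ suc)        ≡⟨ cong₂ _++_ (g≡f zero λ ()) (split (g ∘ suc) (λ p p≢i → g≡f (suc p) (p≢i ∘ FP.suc-injective))) ⟩
  f zero ++ (pre ++ g (suc i) ++ post) ≡⟨ ++-assoc (f zero) pre _ ⟨
  (f zero ++ pre) ++ g (suc i) ++ post ∎
  where open ≡-Reasoning

concat-around₂ : ∀ {n} {A : Set} (f : Vector (List A) n) i j → i ≢ j → Σ (List A) λ pre → ∃₂ λ mid post →
  concat f ≡ pre ++ f i ++ mid ++ f j ++ post ⊎ concat f ≡ pre ++ f j ++ mid ++ f i ++ post
concat-around₂ f zero zero i≢j = ⊥-elim (i≢j refl)
concat-around₂ f zero (suc j) _ with concat-around (f ∘ suc) j
... | pre , post , split = [] , pre , post , inj₁ (cong (f zero ++_) (split (f ∘ suc) (λ _ _ → refl)))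
concat-around₂ f (suc i) zero _ with concat-around (f ∘ suc) i
... | pre , post , split = [] , pre , post , inj₂ (cong (f zero ++_) (split (f ∘ suc) (λ _ _ → refl)))
concat-around₂ f (suc i) (suc j) si≢sj with concat-around₂ (f ∘ suc) i j (si≢sj ∘ cong suc)
... | pre , mid , post , inj₁ eq = f zero ++ pre , mid , post , inj₁ (trans (cong (f zero ++_) eq) (sym (++-assoc (f zero) pre _)))
... | pre , mid , post , inj₂ eq = f zero ++ pre , mid , post , inj₂ (trans (cong (f zero ++_) eq) (sym (++-assoc (f zero) pre _)))

listSum-mono : ∀ {A : Set} {f g : A → ℕ} xs → (∀ x → f x ≤ g x) → listSum (L.map f xs) ≤ listSum (L.map g xs)
listSum-mono [] f≤g = z≤n
listSum-mono (x ∷ xs) f≤g = +-mono-≤ (f≤g x) (listSum-mono xs f≤g)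

listSum-cong : ∀ {X : Set} {f g : X → ℕ} xs → (∀ x → f x ≡ g x) → listSum (L.map f xs) ≡ listSum (L.map g xs)
listSum-cong [] f≡g = refl
listSum-cong (x ∷ xs) f≡g = cong₂ _+_ (f≡g x) (listSum-cong xs f≡g)

listSum-+ : ∀ {X : Set} (f g : X → ℕ) xs → listSum (L.map (λ x → f x + g x) xs) ≡ listSum (L.map f xs) + listSum (L.map g xs)
listSum-+ f g [] = refl
listSum-+ f g (x ∷ xs) = trans (cong (f x + g x +_) (listSum-+ f g xs)) (+-interchange (f x) (g x) _ _)

listSum-𝟙-filter : ∀ {X : Set} (f : X → Bool) (g : X → ℕ) xs →
  listSum (L.map (λ x → 𝟙 (f x) * g x) xs) ≡ listSum (L.map g (filter (T? ∘ f) xs))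
listSum-𝟙-filter f g [] = refl
listSum-𝟙-filter f g (x ∷ xs) with f x
... | true = cong₂ _+_ (+-identityʳ (g x)) (listSum-𝟙-filter f g xs)
... | false = listSum-𝟙-filter f g xs

listSum-bound : ∀ {X : Set} (f : X → ℕ) c B xs → All (λ x → f x * c ≤ B) xs → listSum (L.map f xs) * c ≤ length xs * B
listSum-bound f c B [] [] = z≤n
listSum-bound f c B (x ∷ xs) (fx≤ ∷ rest) = subst (_≤ B + length xs * B) (sym (*-distribʳ-+ c (f x) _))
  (+-mono-≤ fx≤ (listSum-bound f c B xs rest))

length-insert : ∀ {A : Set} (pre : List A) x post → length (pre ++ x ∷ post) ≡ suc (length pre + length post)
length-insert pre x post = trans (length-++ pre) (+-suc (length pre) (length post))

length-++₃ : ∀ {A : Set} (xs ys zs : List A) → length (xs ++ ys ++ zs) ≡ length xs + (length ys + length zs)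
length-++₃ xs ys zs = trans (length-++ xs) (cong (length xs +_) (length-++ ys))

∸≡suc∸suc : ∀ {n m} → m < n → n ∸ m ≡ suc (n ∸ suc m)
∸≡suc∸suc {suc n} {zero} _ = refl
∸≡suc∸suc {suc n} {suc m} m<n = ∸≡suc∸suc (≤-pred m<n)

-- Counting matchings of a list of predicates into a set of holes

Pred : ℕ → Set
Pred k = Vector Bool k

∣_∣ : ∀ {k} → Pred k → ℕ
∣ P ∣ = sum (𝟙 ∘ P)

_∖_ : ∀ {k} → Pred k → Fin k → Pred k
(P ∖ h) h′ = P h′ ∧ not (does (h′ F.≟ h))

≟-sym : ∀ {k} (h h′ : Fin k) → does (h F.≟ h′) ≡ does (h′ F.≟ h)
≟-sym h h′ with h F.≟ h′
... | yes refl = sym (dec-true (h F.≟ h) refl)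
... | no h≢h′ = sym (dec-false (h′ F.≟ h) (h≢h′ ∘ sym))

∖-comm : ∀ {k} (P : Pred k) h h′ x → ((P ∖ h) ∖ h′) x ≡ ((P ∖ h′) ∖ h) x
∖-comm P h h′ x = trans (∧-assoc (P x) _ _)
  (trans (cong (P x ∧_) (∧-comm (not (does (x F.≟ h))) _)) (sym (∧-assoc (P x) _ _)))

∣∣-∖ : ∀ {k} (P : Pred k) h → ∣ P ∣ ≡ 𝟙 (P h) + ∣ P ∖ h ∣
∣∣-∖ P zero = cong (𝟙 (P zero) +_) (begin
  ∣ P ∘ suc ∣                              ≡⟨ sum-cong-≗ (λ p → cong 𝟙 (∧-identityʳ (P (suc p)))) ⟨
  sum (λ p → 𝟙 (P (suc p) ∧ true))          ≡⟨ cong (λ b → 𝟙 b + sum (λ p → 𝟙 (P (suc p) ∧ true))) (∧-zeroʳ (P zero)) ⟨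
  𝟙 (P zero ∧ false) + sum (λ p → 𝟙 (P (suc p) ∧ true)) ∎)
  where open ≡-Reasoning
∣∣-∖ P (suc i) = begin
  𝟙 (P zero) + ∣ P ∘ suc ∣                             ≡⟨ cong (𝟙 (P zero) +_) (∣∣-∖ (P ∘ suc) i) ⟩
  𝟙 (P zero) + (𝟙 (P (suc i)) + ∣ (P ∘ suc) ∖ i ∣)     ≡⟨ +-leftComm (𝟙 (P zero)) (𝟙 (P (suc i))) _ ⟩
  𝟙 (P (suc i)) + (𝟙 (P zero) + ∣ (P ∘ suc) ∖ i ∣)
    ≡⟨ cong (λ b → 𝟙 (P (suc i)) + (𝟙 b + ∣ (P ∘ suc) ∖ i ∣)) (∧-identityʳ (P zero)) ⟨
  𝟙 (P (suc i)) + ∣ P ∖ suc i ∣                        ∎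
  where open ≡-Reasoning

∣∣-∖-∈ : ∀ {k} (P : Pred k) h → P h ≡ true → ∣ P ∣ ≡ suc ∣ P ∖ h ∣
∣∣-∖-∈ P h h∈P = trans (∣∣-∖ P h) (cong (λ b → 𝟙 b + ∣ P ∖ h ∣) h∈P)

#matchings : ∀ {k} → Pred k → List (Pred k) → ℕ
#matchings P [] = 1
#matchings P (A ∷ As) = sum λ h → 𝟙 (P h ∧ A h) * #matchings (P ∖ h) As

#matchings-cong : ∀ {k} {P Q : Pred k} As → (∀ h → P h ≡ Q h) → #matchings P As ≡ #matchings Q As
#matchings-cong [] P≡Q = refl
#matchings-cong (A ∷ As) P≡Q = sum-cong-≗ λ h → cong₂ _*_ (cong (λ b → 𝟙 (b ∧ A h)) (P≡Q h))
  (#matchings-cong As (λ x → cong (_∧ _) (P≡Q x)))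

#matchings-additive : ∀ {k} (P : Pred k) pre post (A B C : Pred k) → (∀ h → 𝟙 (A h) + 𝟙 (B h) ≡ 𝟙 (C h)) →
  #matchings P (pre ++ A ∷ post) + #matchings P (pre ++ B ∷ post) ≡ #matchings P (pre ++ C ∷ post)
#matchings-additive P [] post A B C A+B≡C =
  trans (sym (∑-distrib-+ (λ h → 𝟙 (P h ∧ A h) * M h) (λ h → 𝟙 (P h ∧ B h) * M h))) (sum-cong-≗ λ h → begin
  𝟙 (P h ∧ A h) * M h + 𝟙 (P h ∧ B h) * M h ≡⟨ *-distribʳ-+ (M h) (𝟙 (P h ∧ A h)) _ ⟨
  (𝟙 (P h ∧ A h) + 𝟙 (P h ∧ B h)) * M h     ≡⟨ cong (_* M h) (split (P h) (A+B≡C h)) ⟩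
  𝟙 (P h ∧ C h) * M h                        ∎)
  where
  open ≡-Reasoning
  M : Fin _ → ℕ
  M h = #matchings (P ∖ h) post
  split : ∀ p {a b c} → 𝟙 a + 𝟙 b ≡ 𝟙 c → 𝟙 (p ∧ a) + 𝟙 (p ∧ b) ≡ 𝟙 (p ∧ c)
  split true a+b≡c = a+b≡c
  split false _ = refl
#matchings-additive P (D ∷ pre) post A B C A+B≡C =
  trans (sym (∑-distrib-+ (λ h → 𝟙 (P h ∧ D h) * #matchings (P ∖ h) (pre ++ A ∷ post))
                         (λ h → 𝟙 (P h ∧ D h) * #matchings (P ∖ h) (pre ++ B ∷ post)))) (sum-cong-≗ λ h →
  trans (sym (*-distribˡ-+ (𝟙 (P h ∧ D h)) _ _))
        (cong (𝟙 (P h ∧ D h) *_) (#matchings-additive (P ∖ h) pre post A B C A+B≡C)))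

#matchings-front-swap : ∀ {k} (P A : Pred k) As h h′ →
  𝟙 (P h) * (𝟙 ((P ∖ h) h′ ∧ A h′) * #matchings ((P ∖ h) ∖ h′) As)
    ≡ 𝟙 (P h′ ∧ A h′) * (𝟙 ((P ∖ h′) h) * #matchings ((P ∖ h′) ∖ h) As)
#matchings-front-swap P A As h h′ = begin
  𝟙 (P h) * (𝟙 ((P ∖ h) h′ ∧ A h′) * M)          ≡⟨ *-assoc (𝟙 (P h)) _ M ⟨
  𝟙 (P h) * 𝟙 ((P ∖ h) h′ ∧ A h′) * M            ≡⟨ cong (_* M) (𝟙-∧ (P h) _) ⟨
  𝟙 (P h ∧ ((P ∖ h) h′ ∧ A h′)) * M              ≡⟨ cong₂ (λ b n → 𝟙 b * n) bools
                                                       (#matchings-cong As (∖-comm P h h′)) ⟩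
  𝟙 ((P h′ ∧ A h′) ∧ (P ∖ h′) h) * M′            ≡⟨ cong (_* M′) (𝟙-∧ (P h′ ∧ A h′) _) ⟩
  𝟙 (P h′ ∧ A h′) * 𝟙 ((P ∖ h′) h) * M′          ≡⟨ *-assoc (𝟙 (P h′ ∧ A h′)) _ M′ ⟩
  𝟙 (P h′ ∧ A h′) * (𝟙 ((P ∖ h′) h) * M′)        ∎
  where
  open ≡-Reasoning
  M = #matchings ((P ∖ h) ∖ h′) As
  M′ = #matchings ((P ∖ h′) ∖ h) As
  bools : P h ∧ ((P h′ ∧ not (does (h′ F.≟ h))) ∧ A h′) ≡ (P h′ ∧ A h′) ∧ (P h ∧ not (does (h F.≟ h′)))
  bools = trans (∧-rearrange (P h) (P h′) _ (A h′)) (cong (λ b → (P h′ ∧ A h′) ∧ (P h ∧ not b)) (≟-sym h′ h))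

-- Giving an extra unconstrained pigeon its hole first or last yields the same count.
#matchings-front : ∀ {k} (P : Pred k) As → length As < ∣ P ∣ →
  sum (λ h → 𝟙 (P h) * #matchings (P ∖ h) As) ≡ (∣ P ∣ ∸ length As) * #matchings P As
#matchings-front P [] _ = trans (sum-cong-≗ λ h → *-identityʳ (𝟙 (P h))) (sym (*-identityʳ ∣ P ∣))
#matchings-front P (A ∷ As) |As|<|P| = begin
  sum (λ h → 𝟙 (P h) * sum (term h))                    ≡⟨ sum-cong-≗ (λ h → *-distribˡ-sum (𝟙 (P h)) (term h)) ⟩
  sum (λ h → sum (λ h′ → 𝟙 (P h) * term h h′))         ≡⟨ ∑-comm (λ h h′ → 𝟙 (P h) * term h h′) ⟩
  sum (λ h′ → sum (λ h → 𝟙 (P h) * term h h′))         ≡⟨ sum-cong-≗ column ⟩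
  sum (λ h′ → c * (𝟙 (P h′ ∧ A h′) * #matchings (P ∖ h′) As))
    ≡⟨ *-distribˡ-sum c (λ h′ → 𝟙 (P h′ ∧ A h′) * #matchings (P ∖ h′) As) ⟨
  c * #matchings P (A ∷ As)                          ∎
  where
  open ≡-Reasoning
  term : Fin _ → Fin _ → ℕ
  term h h′ = 𝟙 ((P ∖ h) h′ ∧ A h′) * #matchings ((P ∖ h) ∖ h′) As
  c = ∣ P ∣ ∸ suc (length As)
  column : ∀ h′ → sum (λ h → 𝟙 (P h) * term h h′) ≡ c * (𝟙 (P h′ ∧ A h′) * #matchings (P ∖ h′) As)
  column h′ = begin
    sum (λ h → 𝟙 (P h) * term h h′)
      ≡⟨ sum-cong-≗ (λ h → #matchings-front-swap P A As h h′) ⟩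
    sum (λ h → 𝟙 (P h′ ∧ A h′) * (𝟙 ((P ∖ h′) h) * #matchings ((P ∖ h′) ∖ h) As))
      ≡⟨ *-distribˡ-sum (𝟙 (P h′ ∧ A h′)) (λ h → 𝟙 ((P ∖ h′) h) * #matchings ((P ∖ h′) ∖ h) As) ⟨
    𝟙 (P h′ ∧ A h′) * sum (λ h → 𝟙 ((P ∖ h′) h) * #matchings ((P ∖ h′) ∖ h) As)
      ≡⟨ 𝟙-*-cong (P h′ ∧ A h′) recurse ⟩
    𝟙 (P h′ ∧ A h′) * (c * #matchings (P ∖ h′) As)
      ≡⟨ *-leftComm (𝟙 (P h′ ∧ A h′)) c _ ⟩
    c * (𝟙 (P h′ ∧ A h′) * #matchings (P ∖ h′) As) ∎
    where
    recurse : P h′ ∧ A h′ ≡ true →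
      sum (λ h → 𝟙 ((P ∖ h′) h) * #matchings ((P ∖ h′) ∖ h) As) ≡ c * #matchings (P ∖ h′) As
    recurse h′∈P∩A = trans (#matchings-front (P ∖ h′) As (≤-pred (subst (suc (length As) <_) |P|≡ |As|<|P|)))
      (cong (λ n → (n ∸ suc (length As)) * #matchings (P ∖ h′) As) (sym |P|≡))
      where
      |P|≡ : ∣ P ∣ ≡ suc ∣ P ∖ h′ ∣
      |P|≡ = ∣∣-∖-∈ P h′ (∧-true₁ h′∈P∩A)

#matchings-insert-⊤ : ∀ {k} (P : Pred k) pre post → length pre + length post < ∣ P ∣ →
  #matchings P (pre ++ (λ _ → true) ∷ post) ≡ (∣ P ∣ ∸ (length pre + length post)) * #matchings P (pre ++ post)
#matchings-insert-⊤ P [] post |post|<|P| =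
  trans (sum-cong-≗ λ h → cong (λ b → 𝟙 b * #matchings (P ∖ h) post) (∧-identityʳ (P h)))
        (#matchings-front P post |post|<|P|)
#matchings-insert-⊤ P (B ∷ pre) post <|P| = begin
  sum (λ h → 𝟙 (P h ∧ B h) * #matchings (P ∖ h) (pre ++ (λ _ → true) ∷ post))
    ≡⟨ sum-cong-≗ (λ h → 𝟙-*-cong (P h ∧ B h) (recurse h)) ⟩
  sum (λ h → 𝟙 (P h ∧ B h) * (c * #matchings (P ∖ h) (pre ++ post)))
    ≡⟨ sum-cong-≗ (λ h → *-leftComm (𝟙 (P h ∧ B h)) c _) ⟩
  sum (λ h → c * (𝟙 (P h ∧ B h) * #matchings (P ∖ h) (pre ++ post)))
    ≡⟨ *-distribˡ-sum c (λ h → 𝟙 (P h ∧ B h) * #matchings (P ∖ h) (pre ++ post)) ⟨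
  c * #matchings P (B ∷ pre ++ post) ∎
  where
  open ≡-Reasoning
  c = ∣ P ∣ ∸ suc (length pre + length post)
  recurse : ∀ h → P h ∧ B h ≡ true →
    #matchings (P ∖ h) (pre ++ (λ _ → true) ∷ post) ≡ c * #matchings (P ∖ h) (pre ++ post)
  recurse h h∈P∩B = trans
    (#matchings-insert-⊤ (P ∖ h) pre post (≤-pred (subst (suc (length pre + length post) <_) |P|≡ <|P|)))
    (cong (λ n → (n ∸ suc (length pre + length post)) * #matchings (P ∖ h) (pre ++ post)) (sym |P|≡))
    where
    |P|≡ : ∣ P ∣ ≡ suc ∣ P ∖ h ∣
    |P|≡ = ∣∣-∖-∈ P h (∧-true₁ h∈P∩B)

∖-disjoint : ∀ {k} {P A : Pred k} → (∀ x → P x ∧ A x ≡ false) → ∀ h x → (P ∖ h) x ∧ A x ≡ false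
∖-disjoint {P = P} {A} P∩A h x with P x | A x | P∩A x
... | true | true | ()
... | true | false | _ = ∧-zeroʳ _
... | false | a | _ = refl

#matchings-disjoint : ∀ {k} (P : Pred k) pre post A → (∀ h → P h ∧ A h ≡ false) →
  #matchings P (pre ++ A ∷ post) ≡ 0
#matchings-disjoint P [] post A P∩A = sum-zero λ h → cong (λ b → 𝟙 b * #matchings (P ∖ h) post) (P∩A h)
#matchings-disjoint P (D ∷ pre) post A P∩A = sum-zero λ h →
  𝟙-*-zero (P h ∧ D h) (λ _ → #matchings-disjoint (P ∖ h) pre post A (∖-disjoint {P = P} {A} P∩A h))

#matchings-collide : ∀ {k} (P : Pred k) pre mid post A B a →
  (∀ h → A h ≡ true → h ≡ a) → (∀ h → B h ≡ true → h ≡ a) → #matchings P (pre ++ A ∷ mid ++ B ∷ post) ≡ 0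
#matchings-collide P [] mid post A B a A⊆a B⊆a = sum-zero λ h → 𝟙-*-zero (P h ∧ A h) λ h∈A →
  #matchings-disjoint (P ∖ h) mid post B (disjoint h (A⊆a h (∧-true₂ h∈A)))
  where
  disjoint : ∀ h → h ≡ a → ∀ x → (P ∖ h) x ∧ B x ≡ false
  disjoint h h≡a x with B x in Bx
  ... | false = ∧-zeroʳ _
  ... | true rewrite dec-true (x F.≟ h) (trans (B⊆a x Bx) (sym h≡a)) = cong (_∧ true) (∧-zeroʳ (P x))
#matchings-collide P (D ∷ pre) mid post A B a A⊆a B⊆a = sum-zero λ h →
  𝟙-*-zero (P h ∧ D h) (λ _ → #matchings-collide (P ∖ h) pre mid post A B a A⊆a B⊆a)

Row : ℕ → Set
Row = Vec (Bool × Bool)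

occur : Bool → Bool × Bool → Bool × Bool
occur b (p , q) = if b then (true , q) else (p , true)

satisfiesBit : Bool × Bool → Bool → Bool
satisfiesBit (p , q) c = (not p ∨ c) ∧ (not q ∨ not c)

_⊨_ : ∀ {k} → (Fin k → Bool) → Row k → Bool
bs ⊨ [] = true
bs ⊨ (x ∷ r) = satisfiesBit x (bs zero) ∧ (bs ∘ suc) ⊨ r

mentioned : ∀ {k} → Row k → Bool
mentioned [] = false
mentioned ((p , q) ∷ r) = p ∨ q ∨ mentioned r

satisfiesBit-occur : ∀ b x c → satisfiesBit (occur b x) c ≡ satisfiesBit x c ∧ (c == b)
satisfiesBit-occur true (p , q) true rewrite ∨-zeroʳ (not p) = sym (∧-identityʳ _)
satisfiesBit-occur true (p , q) false = sym (∧-zeroʳ _)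
satisfiesBit-occur false (p , q) true = trans (∧-zeroʳ _) (sym (∧-zeroʳ _))
satisfiesBit-occur false (p , q) false rewrite ∨-zeroʳ (not q) = sym (∧-identityʳ _)

⊨-occur : ∀ {k} (r : Row k) j b bs → bs ⊨ updateAt r j (occur b) ≡ (bs ⊨ r) ∧ (bs j == b)
⊨-occur (x ∷ r) zero b bs =
  trans (cong (_∧ _) (satisfiesBit-occur b x (bs zero))) (∧-swapʳ (satisfiesBit x (bs zero)) _ _)
⊨-occur (x ∷ r) (suc j) b bs =
  trans (cong (satisfiesBit x (bs zero) ∧_) (⊨-occur r j b (bs ∘ suc))) (sym (∧-assoc (satisfiesBit x (bs zero)) _ _))

mentioned-occur : ∀ {k} (r : Row k) j b → mentioned (updateAt r j (occur b)) ≡ true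
mentioned-occur ((p , q) ∷ r) zero true = refl
mentioned-occur ((true , q) ∷ r) zero false = refl
mentioned-occur ((false , q) ∷ r) zero false = refl
mentioned-occur ((p , q) ∷ r) (suc j) b rewrite mentioned-occur r j b | ∨-zeroʳ q = ∨-zeroʳ p

unmentioned-⊨ : ∀ {k} (r : Row k) bs → mentioned r ≡ false → bs ⊨ r ≡ true
unmentioned-⊨ [] bs _ = refl
unmentioned-⊨ ((false , false) ∷ r) bs unmentioned = unmentioned-⊨ r (bs ∘ suc) unmentioned

satisfiesBit-complement : ∀ p q c → p ∨ q ≡ true → satisfiesBit (p , q) c ∧ satisfiesBit (p , q) (not c) ≡ false
satisfiesBit-complement true q true _ = ∧-zeroʳ _
satisfiesBit-complement true q false _ = refl
satisfiesBit-complement false true true _ = refl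
satisfiesBit-complement false true false _ = refl

⊨-complement-head : ∀ {k} p q (r : Row k) bs bs′ → p ∨ q ≡ true → (∀ i → bs′ i ≡ not (bs i)) →
  (bs ⊨ ((p , q) ∷ r)) ∧ (bs′ ⊨ ((p , q) ∷ r)) ≡ false
⊨-complement-head p q r bs bs′ p∨q opp rewrite opp zero =
  ∧-false-interchange (satisfiesBit (p , q) (bs zero)) _ _ _ (satisfiesBit-complement p q (bs zero) p∨q)

⊨-complement : ∀ {k} (r : Row k) bs bs′ → mentioned r ≡ true → (∀ i → bs′ i ≡ not (bs i)) →
  (bs ⊨ r) ∧ (bs′ ⊨ r) ≡ false
⊨-complement ((false , false) ∷ r) bs bs′ ment opp = ⊨-complement r (bs ∘ suc) (bs′ ∘ suc) ment (opp ∘ suc)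
⊨-complement ((true , q) ∷ r) bs bs′ _ opp = ⊨-complement-head true q r bs bs′ refl opp
⊨-complement ((false , true) ∷ r) bs bs′ _ opp = ⊨-complement-head false true r bs bs′ refl opp

occur-comm : ∀ b b′ x → occur b (occur b′ x) ≡ occur b′ (occur b x)
occur-comm true true (p , q) = refl
occur-comm true false (p , q) = refl
occur-comm false true (p , q) = refl
occur-comm false false (p , q) = refl

updateAt-occur-comm : ∀ {k} (r : Row k) j j′ b b′ →
  updateAt (updateAt r j′ (occur b′)) j (occur b) ≡ updateAt (updateAt r j (occur b)) j′ (occur b′)
updateAt-occur-comm r j j′ b b′ with j F.≟ j′
... | no j≢j′ = VP.updateAt-commutes j j′ j≢j′ r
... | yes refl = trans (VP.updateAt-updateAt j r)
  (trans (VP.updateAt-cong j (occur-comm b b′) r) (sym (VP.updateAt-updateAt j r)))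

∧C-comm : ∀ {ℓ} (l l′ : Lit ℓ) E → l ∧C (l′ ∧C E) ≡ l′ ∧C (l ∧C E)
∧C-comm (i , k , b) (i′ , k′ , b′) E with i F.≟ i′
... | no i≢i′ = VP.updateAt-commutes i i′ i≢i′ E
... | yes refl = trans (VP.updateAt-updateAt i E)
  (trans (VP.updateAt-cong i (λ r → updateAt-occur-comm r k k′ b b′) E) (sym (VP.updateAt-updateAt i E)))

bitℕ-+*2 : ∀ r q k → r < 2 → bitℕ (r + q * 2) (suc k) ≡ bitℕ q k
bitℕ-+*2 r q k r<2 = cong (λ n → bitℕ n k) (begin
  (r + q * 2) / 2           ≡⟨ +-distrib-/ r (q * 2) (subst (_< 2) (sym rem≡) r<2) ⟩
  r / 2 + q * 2 / 2         ≡⟨ cong₂ _+_ (m<n⇒m/n≡0 r<2) (m*n/n≡m q 2) ⟩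
  q                         ∎)
  where
  open ≡-Reasoning
  rem≡ : r % 2 + (q * 2) % 2 ≡ r
  rem≡ = trans (cong₂ _+_ (m<n⇒m%n≡m r<2) (m*n%n≡0 q 2)) (+-identityʳ r)

bitℕ-+*2-zero : ∀ r q → r < 2 → bitℕ (r + q * 2) zero ≡ (r ≡ᵇ 1)
bitℕ-+*2-zero r q r<2 = cong (_≡ᵇ 1) (trans ([m+kn]%n≡m%n r q 2) (m<n⇒m%n≡m r<2))

bitℕ-injective : ∀ ℓ {x y} → x < 2 ^ ℓ → y < 2 ^ ℓ → (∀ k → k < ℓ → bitℕ x k ≡ bitℕ y k) → x ≡ y
bitℕ-injective zero x<1 y<1 _ = trans (n<1⇒n≡0 x<1) (sym (n<1⇒n≡0 y<1))
bitℕ-injective (suc ℓ) {x} {y} x< y< same = begin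
  x                   ≡⟨ m≡m%n+[m/n]*n x 2 ⟩
  x % 2 + x / 2 * 2   ≡⟨ cong₂ (λ r q → r + q * 2) rem≡ quot≡ ⟩
  y % 2 + y / 2 * 2   ≡⟨ m≡m%n+[m/n]*n y 2 ⟨
  y                   ∎
  where
  open ≡-Reasoning
  rem≡ : x % 2 ≡ y % 2
  rem≡ = parity-injective (m%n<n x 2) (m%n<n y 2) (same 0 z<s)
    where
    parity-injective : ∀ {r s} → r < 2 → s < 2 → (r ≡ᵇ 1) ≡ (s ≡ᵇ 1) → r ≡ s
    parity-injective {0} {0} _ _ _ = refl
    parity-injective {1} {1} _ _ _ = refl
    parity-injective {0} {1} _ _ ()
    parity-injective {1} {0} _ _ ()
    parity-injective {suc (suc r)} (s≤s (s≤s ())) _ _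
    parity-injective {s = suc (suc s)} _ (s≤s (s≤s ())) _
  quot≡ : x / 2 ≡ y / 2
  quot≡ = bitℕ-injective ℓ (m<n*o⇒m/o<n (subst (x <_) (*-comm 2 (2 ^ ℓ)) x<))
    (m<n*o⇒m/o<n (subst (y <_) (*-comm 2 (2 ^ ℓ)) y<)) (λ k k<ℓ → same (suc k) (s≤s k<ℓ))

bit-injective : ∀ {ℓ} (h a : Hole ℓ) → (∀ k → bit {ℓ} h k ≡ bit {ℓ} a k) → h ≡ a
bit-injective {ℓ} h a same = FP.toℕ-injective (bitℕ-injective ℓ (FP.toℕ<n h) (FP.toℕ<n a)
  (λ k k<ℓ → subst (λ n → bitℕ (toℕ h) n ≡ bitℕ (toℕ a) n) (FP.toℕ-fromℕ< k<ℓ) (same (fromℕ< k<ℓ))))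

-- If j = r + 2q then 2·2^ℓ - 1 - j = (1 - r) + 2(2^ℓ - 1 - q): the last digit flips and the rest recurses.
complement-digits : ∀ r → r < 2 → ∀ q t → 2 * suc (q + t) ≡ suc (r + q * 2) + ((1 ∸ r) + t * 2)
complement-digits 0 _ = solve-∀
complement-digits 1 _ = solve-∀
complement-digits (suc (suc r)) (s≤s (s≤s ()))

bitℕ-complement : ∀ ℓ {j} k → j < 2 ^ ℓ → k < ℓ → bitℕ (2 ^ ℓ ∸ suc j) k ≡ not (bitℕ j k)
bitℕ-complement (suc ℓ) {j} k j< k< = begin
  bitℕ (2 ^ suc ℓ ∸ suc j) k                 ≡⟨ cong₂ (λ n n′ → bitℕ (2 * n ∸ suc n′) k) M≡ (m≡m%n+[m/n]*n j 2) ⟩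
  bitℕ (2 * suc (q + t) ∸ suc j′) k         ≡⟨ cong (λ n → bitℕ (n ∸ suc j′) k) (complement-digits r r<2 q t) ⟩
  bitℕ (suc j′ + j″ ∸ suc j′) k              ≡⟨ cong (λ n → bitℕ n k) (m+n∸m≡n (suc j′) j″) ⟩
  bitℕ j″ k                                  ≡⟨ digits k k< ⟩
  not (bitℕ j′ k)                            ≡⟨ cong (λ n → not (bitℕ n k)) (m≡m%n+[m/n]*n j 2) ⟨
  not (bitℕ j k)                             ∎
  where
  open ≡-Reasoning
  r = j % 2
  q = j / 2
  t = 2 ^ ℓ ∸ suc q
  j′ = r + q * 2
  j″ = (1 ∸ r) + t * 2
  r<2 : r < 2
  r<2 = m%n<n j 2
  q< : q < 2 ^ ℓ
  q< = m<n*o⇒m/o<n (subst (j <_) (*-comm 2 (2 ^ ℓ)) j<)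
  M≡ : 2 ^ ℓ ≡ suc (q + t)
  M≡ = sym (m+[n∸m]≡n q<)
  digits : ∀ k → k < suc ℓ → bitℕ j″ k ≡ not (bitℕ j′ k)
  digits zero _ rewrite bitℕ-+*2-zero (1 ∸ r) t (s≤s (m∸n≤m 1 r)) | bitℕ-+*2-zero r q r<2 with r | r<2
  ... | 0 | _ = refl
  ... | 1 | _ = refl
  ... | suc (suc _) | s≤s (s≤s ())
  digits (suc k) k< = begin
    bitℕ j″ (suc k)   ≡⟨ bitℕ-+*2 (1 ∸ r) t k (s≤s (m∸n≤m 1 r)) ⟩
    bitℕ t k          ≡⟨ bitℕ-complement ℓ k q< (≤-pred k<) ⟩
    not (bitℕ q k)    ≡⟨ cong not (bitℕ-+*2 r q k r<2) ⟨
    not (bitℕ j′ (suc k)) ∎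

bit-opposite : ∀ {ℓ} (h : Hole ℓ) (k : Fin ℓ) → bit {ℓ} (F.opposite h) k ≡ not (bit {ℓ} h k)
bit-opposite {ℓ} h k = trans (cong (λ n → bitℕ n (toℕ k)) (FP.opposite-prop h))
  (bitℕ-complement ℓ (toℕ k) (FP.toℕ<n h) (FP.toℕ<n k))

-- The pseudo-solution

admits : ∀ {ℓ} → Row ℓ → Pred (2 ^ ℓ)
admits r h = bit h ⊨ r

admits-split : ∀ {ℓ} (r : Row ℓ) k h →
  𝟙 (admits (updateAt r k (occur true)) h) + 𝟙 (admits (updateAt r k (occur false)) h) ≡ 𝟙 (admits r h)
admits-split r k h rewrite ⊨-occur r k true (bit h) | ⊨-occur r k false (bit h) with admits r h | bit h k
... | true | true = refl
... | true | false = refl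
... | false | _ = refl

slotWeight : ∀ {ℓ} → Maybe (Hole ℓ) → Row ℓ → ℕ
slotWeight nothing r = 1
slotWeight (just h) r = 𝟙 (admits r h)

slotPreds : ∀ {ℓ} → Maybe (Hole ℓ) → Row ℓ → List (Pred (2 ^ ℓ))
slotPreds (just h) r = []
slotPreds nothing r = if mentioned r then admits r ∷ [] else []

length-slotPreds≤1 : ∀ {ℓ} s (r : Row ℓ) → length (slotPreds s r) ≤ 1
length-slotPreds≤1 (just h) r = z≤n
length-slotPreds≤1 nothing r with mentioned r
... | true = ≤-refl
... | false = z≤n

length-slotPreds-occur : ∀ {ℓ} s (r : Row ℓ) k b b′ →
  length (slotPreds s (updateAt r k (occur b))) ≡ length (slotPreds s (updateAt r k (occur b′)))
length-slotPreds-occur (just h) r k b b′ = refl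
length-slotPreds-occur nothing r k b b′ rewrite mentioned-occur r k b | mentioned-occur r k b′ = refl

length-free : ∀ {ℓ} (r : Row ℓ) → length (slotPreds nothing r) ≡ 𝟙 (mentioned r)
length-free r with mentioned r
... | true = refl
... | false = refl

slotWeight-subadditive : ∀ {ℓ} s (r : Row ℓ) k →
  slotWeight s r ≤ slotWeight s (updateAt r k (occur true)) + slotWeight s (updateAt r k (occur false))
slotWeight-subadditive (just h) r k = ≤-reflexive (sym (admits-split r k h))
slotWeight-subadditive nothing r k = s≤s z≤n

module PseudoSolution {ℓ : ℕ} (σ : Pigeon ℓ → Maybe (Hole ℓ)) (av : Pred (2 ^ ℓ)) where

  row : Conj ℓ → Pigeon ℓ → Row ℓ
  row = V.lookup

  matchedWeight : Conj ℓ → ℕ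
  matchedWeight E = product λ p → slotWeight (σ p) (row E p)

  freePreds : Conj ℓ → List (Pred (2 ^ ℓ))
  freePreds E = concat λ p → slotPreds (σ p) (row E p)

  size : Conj ℓ → ℕ
  size E = length (freePreds E)

  N : ℕ
  N = ∣ av ∣

  completions : List (Pred (2 ^ ℓ)) → ℕ
  completions As = #matchings av As * (N ∸ length As) !

  -- W E / N! is the probability that a uniformly random injection of the free pigeons mentioned in E
  -- into the available holes satisfies E (times 0 or 1 for the matched pigeons); it is meaningful
  -- only while at most N free pigeons are mentioned, beyond that N ∸ length As truncates.
  W : Conj ℓ → ℕ
  W E = matchedWeight E * completions (freePreds E)

  completions-additive : ∀ pre post (A B C : Pred (2 ^ ℓ)) → (∀ h → 𝟙 (A h) + 𝟙 (B h) ≡ 𝟙 (C h)) →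
    completions (pre ++ A ∷ post) + completions (pre ++ B ∷ post) ≡ completions (pre ++ C ∷ post)
  completions-additive pre post A B C A+B≡C = begin
    #matchings av (pre ++ A ∷ post) * F A + #matchings av (pre ++ B ∷ post) * F B
      ≡⟨ cong₂ (λ x y → #matchings av (pre ++ A ∷ post) * x + #matchings av (pre ++ B ∷ post) * y) (F≡ A) (F≡ B) ⟩
    #matchings av (pre ++ A ∷ post) * F′ + #matchings av (pre ++ B ∷ post) * F′
      ≡⟨ *-distribʳ-+ F′ (#matchings av (pre ++ A ∷ post)) _ ⟨
    (#matchings av (pre ++ A ∷ post) + #matchings av (pre ++ B ∷ post)) * F′
      ≡⟨ cong (_* F′) (#matchings-additive av pre post A B C A+B≡C) ⟩
    #matchings av (pre ++ C ∷ post) * F′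
      ≡⟨ cong (#matchings av (pre ++ C ∷ post) *_) (F≡ C) ⟨
    completions (pre ++ C ∷ post) ∎
    where
    open ≡-Reasoning
    F : Pred (2 ^ ℓ) → ℕ
    F X = (N ∸ length (pre ++ X ∷ post)) !
    F′ = (N ∸ suc (length pre + length post)) !
    F≡ : ∀ X → F X ≡ F′
    F≡ X = cong (λ n → (N ∸ n) !) (length-insert pre X post)

  completions-insert : ∀ pre post (A B : Pred (2 ^ ℓ)) → length pre + length post < N →
    (∀ h → 𝟙 (A h) + 𝟙 (B h) ≡ 1) →
    completions (pre ++ A ∷ post) + completions (pre ++ B ∷ post) ≡ completions (pre ++ post)
  completions-insert pre post A B <N A+B≡1 = begin
    completions (pre ++ A ∷ post) + completions (pre ++ B ∷ post)
      ≡⟨ completions-additive pre post A B (λ _ → true) A+B≡1 ⟩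
    #matchings av (pre ++ (λ _ → true) ∷ post) * (N ∸ length (pre ++ (λ _ → true) ∷ post)) !
      ≡⟨ cong₂ (λ x n → x * (N ∸ n) !) (#matchings-insert-⊤ av pre post <N) (length-insert pre _ post) ⟩
    (N ∸ L) * M * (N ∸ suc L) !
      ≡⟨ cong (_* (N ∸ suc L) !) (*-comm (N ∸ L) M) ⟩
    M * (N ∸ L) * (N ∸ suc L) !
      ≡⟨ *-assoc M (N ∸ L) _ ⟩
    M * ((N ∸ L) * (N ∸ suc L) !)
      ≡⟨ cong (λ n → M * (n * (N ∸ suc L) !)) (∸≡suc∸suc <N) ⟩
    M * (suc (N ∸ suc L) !)
      ≡⟨ cong (λ n → M * n !) (trans (cong (N ∸_) (length-++ pre)) (∸≡suc∸suc <N)) ⟨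
    completions (pre ++ post) ∎
    where
    open ≡-Reasoning
    L = length pre + length post
    M = #matchings av (pre ++ post)

  slotTerm : List (Pred (2 ^ ℓ)) → List (Pred (2 ^ ℓ)) → ℕ → Maybe (Hole ℓ) → Row ℓ → ℕ
  slotTerm pre post X s r = slotWeight s r * X * completions (pre ++ slotPreds s r ++ post)

  slotTerm-complement : ∀ pre post X s (r : Row ℓ) k →
    length (pre ++ slotPreds s (updateAt r k (occur true)) ++ post) ≤ N →
    slotTerm pre post X s (updateAt r k (occur true)) + slotTerm pre post X s (updateAt r k (occur false))
      ≡ slotTerm pre post X s r
  slotTerm-complement pre post X (just h) r k _ = begin
    a₁ * X * Q + a₀ * X * Q   ≡⟨ cong (_+ a₀ * X * Q) (*-assoc a₁ X Q) ⟩
    a₁ * (X * Q) + a₀ * X * Q ≡⟨ cong (a₁ * (X * Q) +_) (*-assoc a₀ X Q) ⟩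
    a₁ * (X * Q) + a₀ * (X * Q) ≡⟨ *-distribʳ-+ (X * Q) a₁ a₀ ⟨
    (a₁ + a₀) * (X * Q)       ≡⟨ cong (_* (X * Q)) (admits-split r k h) ⟩
    𝟙 (admits r h) * (X * Q)  ≡⟨ *-assoc (𝟙 (admits r h)) X Q ⟨
    𝟙 (admits r h) * X * Q    ∎
    where
    open ≡-Reasoning
    a₁ = 𝟙 (admits (updateAt r k (occur true)) h)
    a₀ = 𝟙 (admits (updateAt r k (occur false)) h)
    Q = completions (pre ++ post)
  slotTerm-complement pre post X nothing r k ≤N
    rewrite mentioned-occur r k true | mentioned-occur r k false =
    trans (sym (*-distribˡ-+ (1 * X) (completions (pre ++ A₁ ∷ post)) _)) (cong (1 * X *_) (split (mentioned r) refl))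
    where
    A₁ = admits (updateAt r k (occur true))
    A₀ = admits (updateAt r k (occur false))
    split : ∀ m → mentioned r ≡ m →
      completions (pre ++ A₁ ∷ post) + completions (pre ++ A₀ ∷ post)
        ≡ completions (pre ++ (if m then admits r ∷ [] else []) ++ post)
    split true _ = completions-additive pre post A₁ A₀ (admits r) (admits-split r k)
    split false unmentioned = completions-insert pre post A₁ A₀ (subst (_≤ N) (length-insert pre A₁ post) ≤N)
      λ h → trans (admits-split r k h) (cong 𝟙 (unmentioned-⊨ r (bit h) unmentioned))

  AgreeOff : Pigeon ℓ → Conj ℓ → Conj ℓ → Set
  AgreeOff i E′ E = ∀ p → p ≢ i → row E′ p ≡ row E p

  lit-agreeOff : ∀ i k b E → AgreeOff i ((i , k , b) ∧C E) E
  lit-agreeOff i k b E p p≢i = VP.lookup∘updateAt′ p i p≢i E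

  row-lit : ∀ i k b E → row ((i , k , b) ∧C E) i ≡ updateAt (row E i) k (occur b)
  row-lit i k b E = VP.lookup∘updateAt i E

  record Localised (E : Conj ℓ) (i : Pigeon ℓ) : Set where
    field
      pre post : List (Pred (2 ^ ℓ))
      factor : ℕ
      freePreds-local : ∀ E′ → AgreeOff i E′ E → freePreds E′ ≡ pre ++ slotPreds (σ i) (row E′ i) ++ post
      matchedWeight-local : ∀ E′ → AgreeOff i E′ E → matchedWeight E′ ≡ slotWeight (σ i) (row E′ i) * factor

    W-local : ∀ E′ → AgreeOff i E′ E → W E′ ≡ slotTerm pre post factor (σ i) (row E′ i)
    W-local E′ E′≈E = cong₂ _*_ (matchedWeight-local E′ E′≈E) (cong completions (freePreds-local E′ E′≈E))

    size-lit : ∀ k b → size ((i , k , b) ∧C E) ≡ length (pre ++ slotPreds (σ i) (updateAt (row E i) k (occur b)) ++ post)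
    size-lit k b = cong length (trans (freePreds-local ((i , k , b) ∧C E) (lit-agreeOff i k b E))
      (cong (λ r → pre ++ slotPreds (σ i) r ++ post) (row-lit i k b E)))

  localise : ∀ E i → Localised E i
  localise E i with concat-around (λ p → slotPreds (σ p) (row E p)) i
  ... | pre , post , split = record
    { pre = pre
    ; post = post
    ; factor = product (removeAt (λ p → slotWeight (σ p) (row E p)) i)
    ; freePreds-local = λ E′ E′≈E → split (λ p → slotPreds (σ p) (row E′ p)) (λ p p≢i → cong (slotPreds (σ p)) (E′≈E p p≢i))
    ; matchedWeight-local = λ E′ E′≈E → product-agree (λ p → slotWeight (σ p) (row E′ p)) _ i
        (λ p p≢i → cong (slotWeight (σ p)) (E′≈E p p≢i))
    }

  W-complement : ∀ E i k → size ((i , k , true) ∧C E) ≤ N →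
    W ((i , k , true) ∧C E) + W ((i , k , false) ∧C E) ≡ W E
  W-complement E i k ≤N = begin
    W ((i , k , true) ∧C E) + W ((i , k , false) ∧C E)
      ≡⟨ cong₂ _+_ (W-lit true) (W-lit false) ⟩
    slotTerm pre post factor (σ i) (updateAt (row E i) k (occur true))
      + slotTerm pre post factor (σ i) (updateAt (row E i) k (occur false))
      ≡⟨ slotTerm-complement pre post factor (σ i) (row E i) k (subst (_≤ N) (size-lit k true) ≤N) ⟩
    slotTerm pre post factor (σ i) (row E i)
      ≡⟨ W-local E (λ _ _ → refl) ⟨
    W E ∎
    where
    open ≡-Reasoning
    open Localised (localise E i)
    W-lit : ∀ b → W ((i , k , b) ∧C E) ≡ slotTerm pre post factor (σ i) (updateAt (row E i) k (occur b))
    W-lit b = trans (W-local ((i , k , b) ∧C E) (lit-agreeOff i k b E)) (cong (slotTerm pre post factor (σ i)) (row-lit i k b E))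

  size-complement : ∀ E i k b b′ → size ((i , k , b) ∧C E) ≡ size ((i , k , b′) ∧C E)
  size-complement E i k b b′ = begin
    size ((i , k , b) ∧C E)                                   ≡⟨ size-lit k b ⟩
    length (pre ++ slotPreds (σ i) (updateAt (row E i) k (occur b)) ++ post)
      ≡⟨ length-++₃ pre _ post ⟩
    length pre + (length (slotPreds (σ i) (updateAt (row E i) k (occur b))) + length post)
      ≡⟨ cong (λ n → length pre + (n + length post)) (length-slotPreds-occur (σ i) (row E i) k b b′) ⟩
    length pre + (length (slotPreds (σ i) (updateAt (row E i) k (occur b′))) + length post)
      ≡⟨ length-++₃ pre _ post ⟨
    length (pre ++ slotPreds (σ i) (updateAt (row E i) k (occur b′)) ++ post)
      ≡⟨ size-lit k b′ ⟨
    size ((i , k , b′) ∧C E) ∎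
    where
    open ≡-Reasoning
    open Localised (localise E i)

  W-mono : ∀ E i k b → size ((i , k , b) ∧C E) ≤ N → W ((i , k , b) ∧C E) ≤ W E
  W-mono E i k true ≤N =
    subst (W ((i , k , true) ∧C E) ≤_) (W-complement E i k ≤N) (m≤m+n _ (W ((i , k , false) ∧C E)))
  W-mono E i k false ≤N =
    subst (W ((i , k , false) ∧C E) ≤_) (W-complement E i k (subst (_≤ N) (size-complement E i k false true) ≤N))
      (m≤n+m _ (W ((i , k , true) ∧C E)))

  matchedWeight-complement : ∀ E i k → matchedWeight ((i , k , true) ∧C E) ≡ 0 → matchedWeight ((i , k , false) ∧C E) ≡ 0 →
    matchedWeight E ≡ 0
  matchedWeight-complement E i k dead₁ dead₀ = n≤0⇒n≡0 (begin
    matchedWeight E                        ≡⟨ matchedWeight-local E (λ _ _ → refl) ⟩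
    slotWeight (σ i) (row E i) * factor   ≤⟨ *-monoˡ-≤ factor (slotWeight-subadditive (σ i) (row E i) k) ⟩
    (s true + s false) * factor           ≡⟨ *-distribʳ-+ factor (s true) (s false) ⟩
    s true * factor + s false * factor    ≡⟨ cong₂ _+_ (matched-lit true) (matched-lit false) ⟨
    matchedWeight ((i , k , true) ∧C E) + matchedWeight ((i , k , false) ∧C E) ≡⟨ cong₂ _+_ dead₁ dead₀ ⟩
    0 ∎)
    where
    open ≤-Reasoning
    open Localised (localise E i)
    s : Bool → ℕ
    s b = slotWeight (σ i) (updateAt (row E i) k (occur b))
    matched-lit : ∀ b → matchedWeight ((i , k , b) ∧C E) ≡ s b * factor
    matched-lit b = trans (matchedWeight-local ((i , k , b) ∧C E) (lit-agreeOff i k b E))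
      (cong (λ r → slotWeight (σ i) r * factor) (row-lit i k b E))

  W-dead : ∀ E → matchedWeight E ≡ 0 → W E ≡ 0
  W-dead E dead = cong (_* completions (freePreds E)) dead

  W-unmatchable : ∀ E → #matchings av (freePreds E) ≡ 0 → W E ≡ 0
  W-unmatchable E none = trans (cong (λ n → matchedWeight E * (n * (N ∸ size E) !)) none) (*-zeroʳ (matchedWeight E))

  size≡sum : ∀ E → size E ≡ sum (λ p → length (slotPreds (σ p) (row E p)))
  size≡sum E = length-concat (λ p → slotPreds (σ p) (row E p))

  module ClauseBound (a : Hole ℓ) (D : Conj ℓ) (i i′ : Pigeon ℓ) (room : 2 + size D ≤ N) where

    clauseLit : Pigeon ℓ → Fin ℓ → Lit ℓ
    clauseLit j k = (j , k , not (bit a k))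

    holeLit : Pigeon ℓ → Fin ℓ → Lit ℓ
    holeLit j k = (j , k , bit a k)

    placeIn : Pigeon ℓ → List (Fin ℓ) → Conj ℓ → Conj ℓ
    placeIn j [] E = E
    placeIn j (k ∷ ks) E = placeIn j ks (holeLit j k ∧C E)

    clauseWeight : Pigeon ℓ → List (Fin ℓ) → Conj ℓ → ℕ
    clauseWeight j ks E = listSum (L.map (λ k → W (clauseLit j k ∧C E)) ks)

    Near : Conj ℓ → Set
    Near E = ∀ p → p ≢ i → p ≢ i′ → row E p ≡ row D p

    Endpoint : Pigeon ℓ → Set
    Endpoint j = j ≡ i ⊎ j ≡ i′

    near-lit : ∀ E j k b → Near E → Endpoint j → Near ((j , k , b) ∧C E)
    near-lit E j k b near (inj₁ refl) p p≢i p≢i′ = trans (lit-agreeOff j k b E p p≢i) (near p p≢i p≢i′)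
    near-lit E j k b near (inj₂ refl) p p≢i p≢i′ = trans (lit-agreeOff j k b E p p≢i′) (near p p≢i p≢i′)

    near-place : ∀ ks E j → Near E → Endpoint j → Near (placeIn j ks E)
    near-place [] E j near end = near
    near-place (k ∷ ks) E j near end = near-place ks (holeLit j k ∧C E) j (near-lit E j k (bit a k) near end) end

    near-size : ∀ E → Near E → size E ≤ N
    near-size E near = ≤-trans (subst₂ _≤_ (sym (size≡sum E)) (cong (2 +_) (sym (size≡sum D)))
      (sum-≤-2+ _ _ i i′ (λ p p≢i p≢i′ → cong (length ∘ slotPreds (σ p)) (near p p≢i p≢i′))
        (λ p → length-slotPreds≤1 (σ p) (row E p)) (λ p → length-slotPreds≤1 (σ p) (row D p)))) room

    W-lit-mono : ∀ E j j′ k k′ b b′ → Near E → Endpoint j → Endpoint j′ →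
      W ((j , k , b) ∧C ((j′ , k′ , b′) ∧C E)) ≤ W ((j , k , b) ∧C E)
    W-lit-mono E j j′ k k′ b b′ near end end′ rewrite ∧C-comm (j , k , b) (j′ , k′ , b′) E =
      W-mono ((j , k , b) ∧C E) j′ k′ b′ (near-size ((j′ , k′ , b′) ∧C ((j , k , b) ∧C E))
        (near-lit ((j , k , b) ∧C E) j′ k′ b′ (near-lit E j k b near end) end′))

    W-place-mono : ∀ ks E j j′ k b → Near E → Endpoint j → Endpoint j′ →
      W ((j′ , k , b) ∧C placeIn j ks E) ≤ W ((j′ , k , b) ∧C E)
    W-place-mono [] E j j′ k b near end end′ = ≤-refl
    W-place-mono (k₀ ∷ ks) E j j′ k b near end end′ =
      ≤-trans (W-place-mono ks (holeLit j k₀ ∧C E) j j′ k b (near-lit E j k₀ (bit a k₀) near end) end end′)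
              (W-lit-mono E j′ j k k₀ b (bit a k₀) near end′ end)

    W-≤-clause : ∀ ks E j → Near E → Endpoint j → W E ≤ clauseWeight j ks E + W (placeIn j ks E)
    W-≤-clause [] E j near end = ≤-refl
    W-≤-clause (k ∷ ks) E j near end = begin
      W E                                   ≡⟨ W-complement-at (bit a k) ⟨
      W (clauseLit j k ∧C E) + W E′          ≤⟨ +-monoʳ-≤ (W (clauseLit j k ∧C E)) (W-≤-clause ks E′ j near′ end) ⟩
      W (clauseLit j k ∧C E) + (clauseWeight j ks E′ + W (placeIn j ks E′))
        ≤⟨ +-monoʳ-≤ (W (clauseLit j k ∧C E)) (+-monoˡ-≤ (W (placeIn j ks E′)) (listSum-mono ks
             (λ k′ → W-lit-mono E j j k′ k _ _ near end end))) ⟩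
      W (clauseLit j k ∧C E) + (clauseWeight j ks E + W (placeIn j ks E′))
        ≡⟨ +-assoc (W (clauseLit j k ∧C E)) _ _ ⟨
      clauseWeight j (k ∷ ks) E + W (placeIn j (k ∷ ks) E) ∎
      where
      open ≤-Reasoning
      E′ = holeLit j k ∧C E
      near′ = near-lit E j k (bit a k) near end
      W-complement-at : ∀ c → W ((j , k , not c) ∧C E) + W ((j , k , c) ∧C E) ≡ W E
      W-complement-at true = trans (+-comm (W ((j , k , false) ∧C E)) _)
        (W-complement E j k (near-size ((j , k , true) ∧C E) (near-lit E j k true near end)))
      W-complement-at false = W-complement E j k (near-size ((j , k , true) ∧C E) (near-lit E j k true near end))

    clause-inequality : ∀ ks → W (placeIn i′ ks (placeIn i ks D)) ≡ 0 → W D ≤ clauseWeight i ks D + clauseWeight i′ ks D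
    clause-inequality ks collision = begin
      W D                                                 ≤⟨ W-≤-clause ks D i near-D (inj₁ refl) ⟩
      clauseWeight i ks D + W Dᵢ
        ≤⟨ +-monoʳ-≤ (clauseWeight i ks D) (W-≤-clause ks Dᵢ i′ near-Dᵢ (inj₂ refl)) ⟩
      clauseWeight i ks D + (clauseWeight i′ ks Dᵢ + W (placeIn i′ ks Dᵢ))
        ≡⟨ cong (λ n → clauseWeight i ks D + (clauseWeight i′ ks Dᵢ + n)) collision ⟩
      clauseWeight i ks D + (clauseWeight i′ ks Dᵢ + 0)   ≡⟨ cong (clauseWeight i ks D +_) (+-identityʳ _) ⟩
      clauseWeight i ks D + clauseWeight i′ ks Dᵢ
        ≤⟨ +-monoʳ-≤ (clauseWeight i ks D) (listSum-mono ks (λ k → W-place-mono ks D i i′ k _ near-D (inj₁ refl) (inj₂ refl))) ⟩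
      clauseWeight i ks D + clauseWeight i′ ks D          ∎
      where
      open ≤-Reasoning
      Dᵢ = placeIn i ks D
      near-D : Near D
      near-D _ _ _ = refl
      near-Dᵢ = near-place ks D i near-D (inj₁ refl)

    matchesHole : List (Fin ℓ) → Hole ℓ → Bool
    matchesHole ks h = all (λ k → bit h k == bit a k) ks

    matchesHole⇒≡a : ∀ ks h → (∀ k → k ∈ ks) → matchesHole ks h ≡ true → h ≡ a
    matchesHole⇒≡a ks h all-bits matches = bit-injective h a (λ k → ==⇒≡ (all-∈ ks matches (all-bits k)))
      where
      all-∈ : ∀ ks {k} → matchesHole ks h ≡ true → k ∈ ks → (bit h k == bit a k) ≡ true
      all-∈ (k ∷ ks) m (here refl) = ∧-true₁ m
      all-∈ (k ∷ ks) m (there k∈ks) = all-∈ ks (∧-true₂ m) k∈ks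

    row-place-other : ∀ ks E j p → p ≢ j → row (placeIn j ks E) p ≡ row E p
    row-place-other [] E j p p≢j = refl
    row-place-other (k ∷ ks) E j p p≢j = trans (row-place-other ks (holeLit j k ∧C E) j p p≢j) (lit-agreeOff j k (bit a k) E p p≢j)

    admits-place : ∀ ks E j h → admits (row (placeIn j ks E) j) h ≡ admits (row E j) h ∧ matchesHole ks h
    admits-place [] E j h = sym (∧-identityʳ _)
    admits-place (k ∷ ks) E j h = begin
      admits (row (placeIn j ks (holeLit j k ∧C E)) j) h        ≡⟨ admits-place ks (holeLit j k ∧C E) j h ⟩
      admits (row (holeLit j k ∧C E) j) h ∧ matchesHole ks h
        ≡⟨ cong (λ r → admits r h ∧ matchesHole ks h) (row-lit j k (bit a k) E) ⟩
      admits (updateAt (row E j) k (occur (bit a k))) h ∧ matchesHole ks h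
        ≡⟨ cong (_∧ matchesHole ks h) (⊨-occur (row E j) k (bit a k) (bit h)) ⟩
      (admits (row E j) h ∧ (bit h k == bit a k)) ∧ matchesHole ks h ≡⟨ ∧-assoc (admits (row E j) h) _ _ ⟩
      admits (row E j) h ∧ matchesHole (k ∷ ks) h               ∎
      where open ≡-Reasoning

    mentioned-place : ∀ k ks E j → mentioned (row (placeIn j (k ∷ ks) E) j) ≡ true
    mentioned-place k [] E j = trans (cong mentioned (row-lit j k (bit a k) E)) (mentioned-occur (row E j) k (bit a k))
    mentioned-place k (k′ ∷ ks) E j = mentioned-place k′ ks (holeLit j k ∧C E) j

    module Collision (σ-injective : ∀ p p′ h → σ p ≡ just h → σ p′ ≡ just h → p ≡ p′)
      (σ-unavailable : ∀ p h → σ p ≡ just h → av h ≡ false) (i≢i′ : i ≢ i′)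
      (k₀ : Fin ℓ) (ks : List (Fin ℓ)) (all-bits : ∀ k → k ∈ k₀ ∷ ks) where

      Dₐ : Conj ℓ
      Dₐ = placeIn i′ (k₀ ∷ ks) (placeIn i (k₀ ∷ ks) D)

      row-Dₐ-i : row Dₐ i ≡ row (placeIn i (k₀ ∷ ks) D) i
      row-Dₐ-i = row-place-other (k₀ ∷ ks) (placeIn i (k₀ ∷ ks) D) i′ i i≢i′

      only-a : ∀ j → Endpoint j → ∀ h → admits (row Dₐ j) h ≡ true → h ≡ a
      only-a j (inj₁ refl) h adm = matchesHole⇒≡a (k₀ ∷ ks) h all-bits
        (∧-true₂ {admits (row D i) h} (trans (sym (admits-place (k₀ ∷ ks) D i h))
          (trans (cong (λ r → admits r h) (sym row-Dₐ-i)) adm)))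
      only-a j (inj₂ refl) h adm = matchesHole⇒≡a (k₀ ∷ ks) h all-bits
        (∧-true₂ {admits (row (placeIn i (k₀ ∷ ks) D) i′) h} (trans (sym (admits-place (k₀ ∷ ks) _ i′ h)) adm))

      mentioned-Dₐ : ∀ j → Endpoint j → mentioned (row Dₐ j) ≡ true
      mentioned-Dₐ j (inj₁ refl) = trans (cong mentioned row-Dₐ-i) (mentioned-place k₀ ks D i)
      mentioned-Dₐ j (inj₂ refl) = mentioned-place k₀ ks _ i′

      free-slot : ∀ j → Endpoint j → σ j ≡ nothing → slotPreds (σ j) (row Dₐ j) ≡ admits (row Dₐ j) ∷ []
      free-slot j end σj rewrite σj | mentioned-Dₐ j end = refl

      dead-unless-admitted : ∀ j h → σ j ≡ just h → (admits (row Dₐ j) h ≡ true → W Dₐ ≡ 0) → W Dₐ ≡ 0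
      dead-unless-admitted j h σj alive with admits (row Dₐ j) h in adm
      ... | true = alive refl
      ... | false = W-dead Dₐ
        (product-zero (λ p → slotWeight (σ p) (row Dₐ p)) j (trans (cong (λ s → slotWeight s (row Dₐ j)) σj) (cong 𝟙 adm)))

      matched-and-free : ∀ j j′ h → Endpoint j → Endpoint j′ → σ j ≡ just h → admits (row Dₐ j) h ≡ true → σ j′ ≡ nothing → W Dₐ ≡ 0
      matched-and-free j j′ h end end′ σj adm σj′ with concat-around (λ p → slotPreds (σ p) (row Dₐ p)) j′
      ... | pre , post , split = W-unmatchable Dₐ (trans (cong (#matchings av) freePreds-Dₐ)
        (#matchings-disjoint av pre post _ disjoint))
        where
        freePreds-Dₐ : freePreds Dₐ ≡ pre ++ admits (row Dₐ j′) ∷ post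
        freePreds-Dₐ = trans (split _ (λ _ _ → refl)) (cong (λ xs → pre ++ xs ++ post) (free-slot j′ end′ σj′))
        disjoint : ∀ x → av x ∧ admits (row Dₐ j′) x ≡ false
        disjoint x with admits (row Dₐ j′) x in adm′
        ... | false = ∧-zeroʳ (av x)
        ... | true = trans (∧-identityʳ (av x)) (trans (cong av (trans (only-a j′ end′ x adm′) (sym (only-a j end h adm))))
                       (σ-unavailable j h σj))

      both-free : ∀ j j′ → Endpoint j → Endpoint j′ → σ j ≡ nothing → σ j′ ≡ nothing → ∀ pre mid post →
        freePreds Dₐ ≡ pre ++ slotPreds (σ j) (row Dₐ j) ++ mid ++ slotPreds (σ j′) (row Dₐ j′) ++ post → W Dₐ ≡ 0
      both-free j j′ end end′ σj σj′ pre mid post eq = W-unmatchable Dₐ (trans (cong (#matchings av)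
        (trans eq (cong₂ (λ xs ys → pre ++ xs ++ mid ++ ys ++ post) (free-slot j end σj) (free-slot j′ end′ σj′))))
        (#matchings-collide av pre mid post _ _ a (only-a j end) (only-a j′ end′)))

      -- With both pigeons in hole a, two matched pigeons would share a hole, a free pigeon would need
      -- the unavailable hole of a matched one, and two free pigeons would share hole a.
      W-Dₐ≡0 : W Dₐ ≡ 0
      W-Dₐ≡0 with σ i in σi | σ i′ in σi′
      ... | just h | just h′ = dead-unless-admitted i h σi λ adm → dead-unless-admitted i′ h′ σi′ λ adm′ →
        ⊥-elim (i≢i′ (σ-injective i i′ h σi (trans σi′ (cong just (trans (only-a i′ (inj₂ refl) h′ adm′)
          (sym (only-a i (inj₁ refl) h adm)))))))
      ... | just h | nothing = dead-unless-admitted i h σi λ adm → matched-and-free i i′ h (inj₁ refl) (inj₂ refl) σi adm σi′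
      ... | nothing | just h′ = dead-unless-admitted i′ h′ σi′ λ adm′ → matched-and-free i′ i h′ (inj₂ refl) (inj₁ refl) σi′ adm′ σi
      ... | nothing | nothing with concat-around₂ (λ p → slotPreds (σ p) (row Dₐ p)) i i′ i≢i′
      ...   | pre , mid , post , inj₁ eq = both-free i i′ (inj₁ refl) (inj₂ refl) σi σi′ pre mid post eq
      ...   | pre , mid , post , inj₂ eq = both-free i′ i (inj₂ refl) (inj₁ refl) σi′ σi pre mid post eq

·1-nonNeg : ∀ n → 0ℚ ℚ.≤ n · 1ℚ
·1-nonNeg zero = ℚP.≤-refl
·1-nonNeg (suc n) = ℚP.≤-trans (·1-nonNeg n) (subst (ℚ._≤ 1ℚ ℚ.+ n · 1ℚ) (ℚP.+-identityˡ (n · 1ℚ))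
  (ℚP.+-monoˡ-≤ (n · 1ℚ) (ℚP.<⇒≤ (ℚP.positive⁻¹ 1ℚ))))

·1-mono : ∀ {m n} → m ≤ n → m · 1ℚ ℚ.≤ n · 1ℚ
·1-mono {m} {n} m≤n = subst₂ ℚ._≤_ (ℚP.+-identityʳ (m · 1ℚ))
  (trans (sym (×-homo-+ 1ℚ m (n ∸ m))) (cong (_· 1ℚ) (m+[n∸m]≡n m≤n)))
  (ℚP.+-monoʳ-≤ (m · 1ℚ) (·1-nonNeg (n ∸ m)))

·1-pos : ∀ n .{{_ : NonZero n}} → 0ℚ ℚ.< n · 1ℚ
·1-pos (suc n) = ℚP.<-≤-trans (ℚP.positive⁻¹ 1ℚ)
  (subst (ℚ._≤ 1ℚ ℚ.+ n · 1ℚ) (ℚP.+-identityʳ 1ℚ) (ℚP.+-monoʳ-≤ 1ℚ (·1-nonNeg n)))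

module Normalised (d : ℕ) .{{_ : NonZero d}} where

  instance
    d-positive : ℚ.Positive (d · 1ℚ)
    d-positive = ℚ.positive (·1-pos d)

    d-nonZero : ℚ.NonZero (d · 1ℚ)
    d-nonZero = ℚP.pos⇒nonZero (d · 1ℚ)

    1/d-nonNeg : ℚ.NonNegative (1/ (d · 1ℚ))
    1/d-nonNeg = ℚP.pos⇒nonNeg (1/ (d · 1ℚ)) {{ℚP.1/pos⇒pos (d · 1ℚ)}}

  _/d : ℕ → ℚ
  n /d = n · 1ℚ ℚ.* 1/ (d · 1ℚ)

  0/d : 0 /d ≡ 0ℚ
  0/d = ℚP.*-zeroˡ (1/ (d · 1ℚ))

  d/d : d /d ≡ 1ℚ
  d/d = ℚP.*-inverseʳ (d · 1ℚ)

  /d-+ : ∀ m n → m /d ℚ.+ n /d ≡ (m + n) /d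
  /d-+ m n = trans (sym (ℚP.*-distribʳ-+ (1/ (d · 1ℚ)) (m · 1ℚ) (n · 1ℚ))) (cong (ℚ._* 1/ (d · 1ℚ)) (sym (×-homo-+ 1ℚ m n)))

  /d-mono : ∀ {m n} → m ≤ n → m /d ℚ.≤ n /d
  /d-mono m≤n = ℚP.*-monoʳ-≤-nonNeg (1/ (d · 1ℚ)) (·1-mono m≤n)

  /d-nonNeg : ∀ n → 0ℚ ℚ.≤ n /d
  /d-nonNeg n = subst (ℚ._≤ n /d) 0/d (/d-mono {0} {n} z≤n)

module Solution {ℓ′ : ℕ} (σ : Pigeon (suc ℓ′) → Maybe (Hole (suc ℓ′))) (av : Pred (2 ^ suc ℓ′))
  (σ-injective : ∀ p p′ h → σ p ≡ just h → σ p′ ≡ just h → p ≡ p′)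
  (σ-unavailable : ∀ p h → σ p ≡ just h → av h ≡ false) where

  open PseudoSolution {suc ℓ′} σ av public
  open Normalised (N !) {{N !≢0}}

  Good : Conj (suc ℓ′) → Set
  Good D = matchedWeight D ≡ 0 ⊎ 2 + size D ≤ N

  Z : Conj (suc ℓ′) → ℚ.ℚ
  Z E = W E /d

  sumℚ-/d : ∀ {A : Set} (f : A → ℕ) xs → sumℚ (L.map (λ x → f x /d) xs) ≡ listSum (L.map f xs) /d
  sumℚ-/d f [] = sym 0/d
  sumℚ-/d f (x ∷ xs) = trans (cong (f x /d ℚ.+_) (sumℚ-/d f xs)) (/d-+ (f x) _)

  bits : List (Fin (suc ℓ′))
  bits = V.toList (V.allFin (suc ℓ′))

  all-bits : ∀ k → k ∈ bits
  all-bits k = VMP.∈-toList⁺ (VMP.∈-allFin⁺ k)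

  sat-clause : ∀ a i i′ (i≢i′ : i ≢ i′) D → Good D → Sat Z (clauseC a i i′ i≢i′ D)
  sat-clause a i i′ i≢i′ D good rewrite sumℚ-/d (λ l → W (l ∧C D)) (clauseLits a i i′) = /d-mono (bound good)
    where
    w : Lit (suc ℓ′) → ℕ
    w l = W (l ∧C D)
    bound : Good D → W D ≤ listSum (L.map w (clauseLits a i i′))
    bound (inj₁ dead) = subst (_≤ listSum (L.map w (clauseLits a i i′))) (sym (W-dead D dead)) z≤n
    bound (inj₂ room) = subst (W D ≤_) (sym weights) (clause-inequality bits (W-Dₐ≡0 zero ks all-bits))
      where
      open ClauseBound a D i i′ room
      open Collision σ-injective σ-unavailable i≢i′
      ks = V.toList (V.tabulate {n = ℓ′} suc)
      weight-lits : ∀ j → listSum (L.map w (V.toList (V.map (clauseLit j) (V.allFin (suc ℓ′))))) ≡ clauseWeight j bits D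
      weight-lits j = cong listSum (trans (cong (L.map w) (VP.toList-map (clauseLit j) (V.allFin (suc ℓ′))))
        (sym (map-∘ bits)))
      weights : listSum (L.map w (clauseLits a i i′)) ≡ clauseWeight i bits D + clauseWeight i′ bits D
      weights = trans (cong listSum (map-++ w (V.toList (V.map (clauseLit i) (V.allFin (suc ℓ′)))) _))
        (trans (sum-++ (L.map w (V.toList (V.map (clauseLit i) (V.allFin (suc ℓ′))))) _)
          (cong₂ _+_ (weight-lits i) (weight-lits i′)))

  room⇒fits : ∀ E → 2 + size E ≤ N → size E ≤ N
  room⇒fits E room = ≤-trans (m≤n+m (size E) 2) room

  sat-complement : ∀ i k D → Good ((i , k , true) ∧C D) → Good ((i , k , false) ∧C D) → Sat Z (complC i k D)
  sat-complement i k D good₁ good₀ = trans (/d-+ (W ((i , k , true) ∧C D)) _) (cong _/d (sum-W good₁ good₀))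
    where
    sum-W : Good ((i , k , true) ∧C D) → Good ((i , k , false) ∧C D) →
      W ((i , k , true) ∧C D) + W ((i , k , false) ∧C D) ≡ W D
    sum-W (inj₂ room) _ = W-complement D i k (room⇒fits ((i , k , true) ∧C D) room)
    sum-W (inj₁ _) (inj₂ room) =
      W-complement D i k (subst (_≤ N) (size-complement D i k false true) (room⇒fits ((i , k , false) ∧C D) room))
    sum-W (inj₁ dead₁) (inj₁ dead₀) = trans (cong₂ _+_ (W-dead ((i , k , true) ∧C D) dead₁) (W-dead ((i , k , false) ∧C D) dead₀))
      (sym (W-dead D (matchedWeight-complement D i k dead₁ dead₀)))

  sat-bound : ∀ l D → Good (l ∧C D) → Sat Z (boundC l D)
  sat-bound (i , k , b) D good = /d-nonNeg (W ((i , k , b) ∧C D)) , /d-mono (bound good)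
    where
    bound : Good ((i , k , b) ∧C D) → W ((i , k , b) ∧C D) ≤ W D
    bound (inj₁ dead) = subst (_≤ W D) (sym (W-dead ((i , k , b) ∧C D) dead)) z≤n
    bound (inj₂ room) = W-mono D i k b (room⇒fits ((i , k , b) ∧C D) room)

  GoodTerms : Constraint (suc ℓ′) → Set
  GoodTerms c = ∀ D → D ∈ terms c → Good D

  sat : ∀ c → GoodTerms c → Sat Z c
  sat (clauseC a i i′ i≢i′ D) good = sat-clause a i i′ i≢i′ D (good D (here refl))
  sat (complC i k D) good = sat-complement i k D (good _ (there (here refl))) (good _ (there (there (here refl))))
  sat (boundC l D) good = sat-bound l D (good _ (there (here refl)))

  W-empty : W emptyC ≡ N !
  W-empty = begin
    matchedWeight emptyC * completions (freePreds emptyC)  ≡⟨ cong₂ (λ x ys → x * completions ys) matched-empty free-empty ⟩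
    1 * (1 * N !)                                        ≡⟨ trans (*-identityˡ _) (*-identityˡ _) ⟩
    N !                                                  ∎
    where
    open ≡-Reasoning
    emptyRow : ∀ p → row emptyC p ≡ V.replicate (suc ℓ′) (false , false)
    emptyRow p = VP.lookup-replicate p _
    unmentioned : ∀ {k} → mentioned (V.replicate k (false , false)) ≡ false
    unmentioned {zero} = refl
    unmentioned {suc k} = unmentioned {k}
    matched-empty : matchedWeight emptyC ≡ 1
    matched-empty = product-ones λ p → trans (cong (slotWeight (σ p)) (emptyRow p)) (slot (σ p))
      where
      slot : ∀ s → slotWeight s (V.replicate (suc ℓ′) (false , false)) ≡ 1
      slot nothing = refl
      slot (just h) = cong 𝟙 (unmentioned-⊨ (V.replicate (suc ℓ′) (false , false)) (bit h) (unmentioned {suc ℓ′}))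
    free-empty : freePreds emptyC ≡ []
    free-empty = concat-[] λ p → trans (cong (slotPreds (σ p)) (emptyRow p)) (slot (σ p))
      where
      slot : ∀ s → slotPreds s (V.replicate (suc ℓ′) (false , false)) ≡ []
      slot nothing rewrite unmentioned {suc ℓ′} = refl
      slot (just h) = refl

  solution : ∀ R → (∀ c → c ∈ R → GoodTerms c) → Σ (Conj (suc ℓ′) → ℚ.ℚ) λ Z → (Z emptyC ≡ ℚ.1ℚ) × All (Sat Z) R
  solution R good = Z , trans (cong _/d W-empty) d/d , All.tabulate λ {c} c∈R → sat c (good c c∈R)

-- The union bound and the numerical estimates

#choices : (Bool × Bool → Bool) → ℕ
#choices g = 𝟙 (g (false , false)) + 𝟙 (g (false , true)) + 𝟙 (g (true , false)) + 𝟙 (g (true , true))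

#choices-distrib : ∀ g P → #choices g * P
  ≡ 𝟙 (g (false , false)) * P + 𝟙 (g (false , true)) * P + 𝟙 (g (true , false)) * P + 𝟙 (g (true , true)) * P
#choices-distrib g P = distrib (𝟙 (g (false , false))) (𝟙 (g (false , true))) (𝟙 (g (true , false))) (𝟙 (g (true , true))) P
  where
  distrib : ∀ a b c d p → (a + b + c + d) * p ≡ a * p + b * p + c * p + d * p
  distrib = solve-∀

-- D survives (no j kills it) for exactly product (λ j → #choices (C j D)) of the 4 ^ m choices x.
union-bound : ∀ {X : Set} m (C : Fin m → X → Bool × Bool → Bool) (Ds : List X) →
  listSum (L.map (λ D → product λ j → #choices (C j D)) Ds) < 4 ^ m →
  Σ (Fin m → Bool × Bool) λ x → All (λ D → ∃ λ j → C j D (x j) ≡ false) Ds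
union-bound zero C [] _ = (λ ()) , []
union-bound zero C (D ∷ Ds) (s≤s ())
union-bound {X} (suc m) C Ds total< =
  let ch , small = small-choice
      x′ , kills = union-bound m (C ∘ suc) (filter (kept ch) Ds) small
  in (λ { zero → ch ; (suc j) → x′ j }) , filter⁻ (kept ch) (All.map (λ { (j , dead) → suc j , dead }) kills)
                   (All.map (λ ¬kept → zero , ≢true⇒≡false ¬kept) (all-filter (¬? ∘ kept ch) Ds))
  where
  kept : (ch : Bool × Bool) (D : X) → Dec (T (C zero D ch))
  kept ch D = T? (C zero D ch)
  rest : X → ℕ
  rest D = product λ j → #choices (C (suc j) D)
  S : Bool × Bool → ℕ
  S ch = listSum (L.map rest (filter (kept ch) Ds))
  part : Bool × Bool → X → ℕ
  part ch D = 𝟙 (C zero D ch) * rest D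
  total : ℕ
  total = listSum (L.map (λ D → product λ j → #choices (C j D)) Ds)
  expand : total ≡ S (false , false) + S (false , true) + S (true , false) + S (true , true)
  expand = begin
    total
      ≡⟨ listSum-cong Ds (λ D → #choices-distrib (C zero D) (rest D)) ⟩
    listSum (L.map (λ D → part (false , false) D + part (false , true) D + part (true , false) D + part (true , true) D) Ds)
      ≡⟨ listSum-+ (λ D → part (false , false) D + part (false , true) D + part (true , false) D) (part (true , true)) Ds ⟩
    listSum (L.map (λ D → part (false , false) D + part (false , true) D + part (true , false) D) Ds) + Σpart (true , true)
      ≡⟨ cong (_+ Σpart (true , true)) (listSum-+ (λ D → part (false , false) D + part (false , true) D) (part (true , false)) Ds) ⟩
    listSum (L.map (λ D → part (false , false) D + part (false , true) D) Ds) + Σpart (true , false) + Σpart (true , true)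
      ≡⟨ cong (λ n → n + Σpart (true , false) + Σpart (true , true)) (listSum-+ (part (false , false)) (part (false , true)) Ds) ⟩
    Σpart (false , false) + Σpart (false , true) + Σpart (true , false) + Σpart (true , true)
      ≡⟨ cong₂ _+_ (cong₂ _+_ (cong₂ _+_ (Σpart≡S _) (Σpart≡S _)) (Σpart≡S _)) (Σpart≡S _) ⟩
    S (false , false) + S (false , true) + S (true , false) + S (true , true) ∎
    where
    open ≡-Reasoning
    Σpart : Bool × Bool → ℕ
    Σpart ch = listSum (L.map (part ch) Ds)
    Σpart≡S : ∀ ch → Σpart ch ≡ S ch
    Σpart≡S ch = listSum-𝟙-filter (λ D → C zero D ch) rest Ds
  small-choice : Σ (Bool × Bool) λ ch → S ch < 4 ^ m
  small-choice with S (false , false) <? 4 ^ m | S (false , true) <? 4 ^ m | S (true , false) <? 4 ^ m | S (true , true) <? 4 ^ m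
  ... | yes s< | _ | _ | _ = _ , s<
  ... | no _ | yes s< | _ | _ = _ , s<
  ... | no _ | no _ | yes s< | _ = _ , s<
  ... | no _ | no _ | no _ | yes s< = _ , s<
  ... | no s≮₁ | no s≮₂ | no s≮₃ | no s≮₄ = ⊥-elim (<⇒≱ total< (begin
    4 * 4 ^ m                                 ≡⟨ four-times (4 ^ m) ⟩
    4 ^ m + 4 ^ m + 4 ^ m + 4 ^ m             ≤⟨ +-mono-≤ (+-mono-≤ (+-mono-≤ (≮⇒≥ s≮₁) (≮⇒≥ s≮₂)) (≮⇒≥ s≮₃)) (≮⇒≥ s≮₄) ⟩
    S (false , false) + S (false , true) + S (true , false) + S (true , true) ≡⟨ expand ⟨
    total                                     ∎))
    where
    open ≤-Reasoning
    four-times : ∀ q → 4 * q ≡ q + q + q + q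
    four-times = solve-∀

*-^-distrib : ∀ a b k → (a * b) ^ k ≡ a ^ k * b ^ k
*-^-distrib a b zero = refl
*-^-distrib a b (suc k) = trans (cong (a * b *_) (*-^-distrib a b k)) ([m*n]*[o*p]≡[m*o]*[n*p] a b (a ^ k) (b ^ k))

product-bound : ∀ m (c : Fin m → ℕ) (used : Fin m → Bool) → (∀ j → c j + 𝟙 (used j) ≤ 4) →
  product c * 4 ^ sum (𝟙 ∘ used) ≤ 3 ^ sum (𝟙 ∘ used) * 4 ^ m
product-bound zero c used c≤ = ≤-refl
product-bound (suc m) c used c≤ with used zero | c≤ zero
... | true | c₀+1≤4 = begin
  c zero * P * (4 * 4 ^ q)   ≡⟨ rearrange (c zero) P (4 ^ q) ⟩
  c zero * 4 * (P * 4 ^ q)   ≤⟨ *-mono-≤ (*-monoˡ-≤ 4 (≤-pred (subst (_≤ 4) (+-comm (c zero) 1) c₀+1≤4))) IH ⟩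
  3 * 4 * (3 ^ q * 4 ^ m)    ≡⟨ rearrange 3 (3 ^ q) (4 ^ m) ⟨
  3 * 3 ^ q * (4 * 4 ^ m)    ∎
  where
  open ≤-Reasoning
  P = product (c ∘ suc)
  q = sum (𝟙 ∘ used ∘ suc)
  IH = product-bound m (c ∘ suc) (used ∘ suc) (c≤ ∘ suc)
  rearrange : ∀ a b x → a * b * (4 * x) ≡ a * 4 * (b * x)
  rearrange = solve-∀
... | false | c₀≤4 = begin
  c zero * P * 4 ^ q         ≡⟨ *-assoc (c zero) P (4 ^ q) ⟩
  c zero * (P * 4 ^ q)       ≤⟨ *-mono-≤ (subst (_≤ 4) (+-identityʳ (c zero)) c₀≤4) IH ⟩
  4 * (3 ^ q * 4 ^ m)        ≡⟨ *-leftComm 4 (3 ^ q) (4 ^ m) ⟩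
  3 ^ q * (4 * 4 ^ m)        ∎
  where
  open ≤-Reasoning
  P = product (c ∘ suc)
  q = sum (𝟙 ∘ used ∘ suc)
  IH = product-bound m (c ∘ suc) (used ∘ suc) (c≤ ∘ suc)

threshold-bound : ∀ P {q₀ q} m → q₀ ≤ q → P * 4 ^ q ≤ 3 ^ q * 4 ^ m → P * 4 ^ q₀ ≤ 3 ^ q₀ * 4 ^ m
threshold-bound P {q₀} {q} m q₀≤q bound = *-cancelʳ-≤ (P * 4 ^ q₀) (3 ^ q₀ * 4 ^ m) (4 ^ d) {{m^n≢0 4 d}} (begin
  P * 4 ^ q₀ * 4 ^ d       ≡⟨ *-assoc P (4 ^ q₀) (4 ^ d) ⟩
  P * (4 ^ q₀ * 4 ^ d)     ≡⟨ cong (P *_) (^-distribˡ-+-* 4 q₀ d) ⟨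
  P * 4 ^ (q₀ + d)         ≡⟨ cong (λ n → P * 4 ^ n) q₀+d≡q ⟩
  P * 4 ^ q                ≤⟨ bound ⟩
  3 ^ q * 4 ^ m            ≡⟨ cong (λ n → 3 ^ n * 4 ^ m) q₀+d≡q ⟨
  3 ^ (q₀ + d) * 4 ^ m     ≡⟨ cong (_* 4 ^ m) (^-distribˡ-+-* 3 q₀ d) ⟩
  3 ^ q₀ * 3 ^ d * 4 ^ m   ≤⟨ *-monoˡ-≤ (4 ^ m) (*-monoʳ-≤ (3 ^ q₀) (^-monoˡ-≤ d (n≤1+n 3))) ⟩
  3 ^ q₀ * 4 ^ d * 4 ^ m   ≡⟨ swap (3 ^ q₀) (4 ^ d) (4 ^ m) ⟩
  3 ^ q₀ * 4 ^ m * 4 ^ d   ∎)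
  where
  open ≤-Reasoning
  d = q ∸ q₀
  q₀+d≡q : q₀ + d ≡ q
  q₀+d≡q = m+[n∸m]≡n q₀≤q
  swap : ∀ a b c → a * b * c ≡ a * c * b
  swap = solve-∀

root-16 : ∀ u x y z → x ^ 16 * y ^ (16 * u) < z ^ (16 * u) → x * y ^ u < z ^ u
root-16 u x y z bound with x * y ^ u <? z ^ u
... | yes < = <
... | no ≮ = ⊥-elim (<⇒≱ bound (begin
  z ^ (16 * u)            ≡⟨ cong (z ^_) (*-comm 16 u) ⟩
  z ^ (u * 16)            ≡⟨ ^-*-assoc z u 16 ⟨
  (z ^ u) ^ 16            ≤⟨ ^-monoˡ-≤ 16 (≮⇒≥ ≮) ⟩
  (x * y ^ u) ^ 16        ≡⟨ *-^-distrib x (y ^ u) 16 ⟩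
  x ^ 16 * (y ^ u) ^ 16   ≡⟨ cong (x ^ 16 *_) (trans (^-*-assoc y u 16) (cong (y ^_) (*-comm u 16))) ⟩
  x ^ 16 * y ^ (16 * u)   ∎))
  where open ≤-Reasoning

6^u3^v≤5^u4^v : ∀ u → 6 ^ suc u * 3 ^ (6 + 8 * u) ≤ 5 ^ suc u * 4 ^ (6 + 8 * u)
6^u3^v≤5^u4^v u = begin
  6 ^ suc u * 3 ^ (6 + 8 * u)     ≡⟨ cong (6 ^ suc u *_) (trans (^-distribˡ-+-* 3 6 (8 * u)) (cong (729 *_) (sym (^-*-assoc 3 8 u)))) ⟩
  6 * 6 ^ u * (729 * 6561 ^ u)   ≡⟨ regroup 6 729 4374 (6 ^ u) (6561 ^ u) refl ⟩
  4374 * (6 ^ u * 6561 ^ u)      ≡⟨ cong (4374 *_) (*-^-distrib 6 6561 u) ⟨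
  4374 * 39366 ^ u               ≤⟨ *-mono-≤ (≤ᵇ⇒≤ 4374 20480 _) (^-monoˡ-≤ u (≤ᵇ⇒≤ 39366 327680 _)) ⟩
  20480 * 327680 ^ u             ≡⟨ cong (20480 *_) (*-^-distrib 5 65536 u) ⟩
  20480 * (5 ^ u * 65536 ^ u)    ≡⟨ regroup 5 4096 20480 (5 ^ u) (65536 ^ u) refl ⟨
  5 * 5 ^ u * (4096 * 65536 ^ u) ≡⟨ cong (5 ^ suc u *_) (trans (^-distribˡ-+-* 4 6 (8 * u)) (cong (4096 *_) (sym (^-*-assoc 4 8 u)))) ⟨
  5 ^ suc u * 4 ^ (6 + 8 * u)    ∎
  where
  open ≤-Reasoning
  regroup : ∀ a b c x y → a * b ≡ c → a * x * (b * y) ≡ c * (x * y)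
  regroup a b c x y refl = [m*n]*[o*p]≡[m*o]*[n*p] a x b y

restriction-estimate : ∀ u t → 1 ≤ u → (t + 1) ^ 16 * 5 ^ (16 * u) < 6 ^ (16 * u) → t * 3 ^ (8 * u ∸ 2) < 4 ^ (8 * u ∸ 2)
restriction-estimate (suc u) t _ bound = subst (λ n → t * 3 ^ n < 4 ^ n) (sym (cong (_∸ 2) (*-suc 8 u)))
  (*-cancelʳ-< (5 ^ suc u) (t * 3 ^ v) (4 ^ v) (begin-strict
  t * 3 ^ v * 5 ^ suc u        ≡⟨ *-assoc t (3 ^ v) (5 ^ suc u) ⟩
  t * (3 ^ v * 5 ^ suc u)      ≡⟨ cong (t *_) (*-comm (3 ^ v) (5 ^ suc u)) ⟩
  t * (5 ^ suc u * 3 ^ v)      ≡⟨ *-assoc t (5 ^ suc u) (3 ^ v) ⟨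
  t * 5 ^ suc u * 3 ^ v        <⟨ *-monoˡ-< (3 ^ v) {{m^n≢0 3 v}} t5<6 ⟩
  6 ^ suc u * 3 ^ v            ≤⟨ 6^u3^v≤5^u4^v u ⟩
  5 ^ suc u * 4 ^ v            ≡⟨ *-comm (5 ^ suc u) (4 ^ v) ⟩
  4 ^ v * 5 ^ suc u            ∎))
  where
  open ≤-Reasoning
  v = 6 + 8 * u
  t5<6 : t * 5 ^ suc u < 6 ^ suc u
  t5<6 = ≤-<-trans (*-monoˡ-≤ (5 ^ suc u) (m≤m+n t 1)) (root-16 (suc u) (t + 1) 5 6 bound)

-- The random restriction

opposite-injective : ∀ {n} {i j : Fin n} → opposite i ≡ opposite j → i ≡ j
opposite-injective {i = i} {j} eq = trans (sym (FP.opposite-involutive i)) (trans (cong opposite eq) (FP.opposite-involutive j))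

left≢right : ∀ {m n} (i : Fin m) (j : Fin n) → i ↑ˡ n ≢ m ↑ʳ j
left≢right {m} {n} i j eq = <⇒≱ (FP.toℕ<n i) (begin
  m               ≤⟨ m≤m+n m (toℕ j) ⟩
  m + toℕ j       ≡⟨ FP.toℕ-↑ʳ m j ⟨
  toℕ (m ↑ʳ j)    ≡⟨ cong toℕ eq ⟨
  toℕ (i ↑ˡ n)    ≡⟨ FP.toℕ-↑ˡ i n ⟩
  toℕ i           ∎)
  where open ≤-Reasoning

-- Pair j consists of the pigeons 1 + j and 1 + m + j and of the holes j and 2m - 1 - j, whose bits
-- are complementary; the choice x j = (c , h) of a restriction matches pigeon c of the pair to hole h.
module Pairing (ℓ′ : ℕ) where

  m : ℕ
  m = 2 ^ ℓ′

  m+0≡m : m + 0 ≡ m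
  m+0≡m = +-identityʳ m

  toRight : Fin m → Fin (m + 0)
  toRight = F.cast (sym m+0≡m)

  fromRight : Fin (m + 0) → Fin m
  fromRight = F.cast m+0≡m

  fromRight∘toRight : ∀ j → fromRight (toRight j) ≡ j
  fromRight∘toRight = FP.cast-involutive m+0≡m (sym m+0≡m)

  toRight∘fromRight : ∀ y → toRight (fromRight y) ≡ y
  toRight∘fromRight = FP.cast-involutive (sym m+0≡m) m+0≡m

  hole : Fin m → Bool → Hole (suc ℓ′)
  hole j false = j ↑ˡ (m + 0)
  hole j true = m ↑ʳ toRight (opposite j)

  pigeon : Fin m → Bool → Pigeon (suc ℓ′)
  pigeon j false = suc (j ↑ˡ (m + 0))
  pigeon j true = suc (m ↑ʳ toRight j)

  hole-true : ∀ j → hole j true ≡ opposite (hole j false)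
  hole-true j = FP.toℕ-injective (begin
    toℕ (m ↑ʳ toRight (opposite j))          ≡⟨ FP.toℕ-↑ʳ m (toRight (opposite j)) ⟩
    m + toℕ (toRight (opposite j))            ≡⟨ cong (m +_) (FP.toℕ-cast (sym m+0≡m) (opposite j)) ⟩
    m + toℕ (opposite j)                      ≡⟨ cong (m +_) (FP.opposite-prop j) ⟩
    m + (m ∸ suc (toℕ j))                     ≡⟨ cong (λ n → m + (n ∸ suc (toℕ j))) m+0≡m ⟨
    m + ((m + 0) ∸ suc (toℕ j))               ≡⟨ +-∸-assoc m (subst (suc (toℕ j) ≤_) (sym m+0≡m) (FP.toℕ<n j)) ⟨
    m + (m + 0) ∸ suc (toℕ j)                 ≡⟨ cong (λ n → m + (m + 0) ∸ suc n) (FP.toℕ-↑ˡ j (m + 0)) ⟨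
    m + (m + 0) ∸ suc (toℕ (j ↑ˡ (m + 0)))    ≡⟨ FP.opposite-prop (j ↑ˡ (m + 0)) ⟨
    toℕ (opposite (j ↑ˡ (m + 0)))             ∎)
    where open ≡-Reasoning

  bit-hole-true : ∀ j k → bit {suc ℓ′} (hole j true) k ≡ not (bit {suc ℓ′} (hole j false) k)
  bit-hole-true j k = trans (cong (λ h → bit {suc ℓ′} h k) (hole-true j)) (bit-opposite (hole j false) k)

  hole-injective : ∀ j j′ b b′ → hole j b ≡ hole j′ b′ → j ≡ j′
  hole-injective j j′ false false eq = FP.↑ˡ-injective (m + 0) j j′ eq
  hole-injective j j′ true true eq =
    FP.↑ˡ-injective (m + 0) j j′ (opposite-injective (trans (sym (hole-true j)) (trans eq (hole-true j′))))
  hole-injective j j′ false true eq = ⊥-elim (left≢right j (toRight (opposite j′)) eq)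
  hole-injective j j′ true false eq = ⊥-elim (left≢right j′ (toRight (opposite j)) (sym eq))

  pairMentioned : Conj (suc ℓ′) → Fin m → Bool
  pairMentioned D j = mentioned (V.lookup D (pigeon j false)) ∨ mentioned (V.lookup D (pigeon j true))

  #mentionedPairs : Conj (suc ℓ′) → ℕ
  #mentionedPairs D = sum (𝟙 ∘ pairMentioned D)

  pairAdmits : Fin m → Conj (suc ℓ′) → Bool × Bool → Bool
  pairAdmits j D (c , h) = admits (V.lookup D (pigeon j c)) (hole j h)

  row-pair-bound : ∀ j (r : Row (suc ℓ′)) → 𝟙 (admits r (hole j false)) + 𝟙 (admits r (hole j true)) + 𝟙 (mentioned r) ≤ 2
  row-pair-bound j r with mentioned r in ment
  ... | false = +-mono-≤ (+-mono-≤ (𝟙≤1 (admits r (hole j false))) (𝟙≤1 (admits r (hole j true)))) z≤n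
  ... | true = subst (_≤ 2) (+-comm 1 _) (s≤s (exclusive (admits r (hole j false)) (admits r (hole j true))
    (⊨-complement r (bit (hole j false)) (bit (hole j true)) ment (bit-hole-true j))))
    where
    exclusive : ∀ a b → a ∧ b ≡ false → 𝟙 a + 𝟙 b ≤ 1
    exclusive true false _ = ≤-refl
    exclusive false b _ = 𝟙≤1 b

  pair-choices-bound : ∀ D j → #choices (pairAdmits j D) + 𝟙 (pairMentioned D j) ≤ 4
  pair-choices-bound D j = begin
    a₀ + b₀ + a₁ + b₁ + 𝟙 (m₀ ∨ m₁)         ≤⟨ +-monoʳ-≤ (a₀ + b₀ + a₁ + b₁) (𝟙-∨ m₀ m₁) ⟩
    a₀ + b₀ + a₁ + b₁ + (𝟙 m₀ + 𝟙 m₁)       ≡⟨ regroup a₀ b₀ a₁ b₁ (𝟙 m₀) (𝟙 m₁) ⟩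
    (a₀ + b₀ + 𝟙 m₀) + (a₁ + b₁ + 𝟙 m₁)     ≤⟨ +-mono-≤ (row-pair-bound j r₀) (row-pair-bound j r₁) ⟩
    4                                       ∎
    where
    open ≤-Reasoning
    r₀ = V.lookup D (pigeon j false)
    r₁ = V.lookup D (pigeon j true)
    m₀ = mentioned r₀
    m₁ = mentioned r₁
    a₀ = 𝟙 (admits r₀ (hole j false))
    b₀ = 𝟙 (admits r₀ (hole j true))
    a₁ = 𝟙 (admits r₁ (hole j false))
    b₁ = 𝟙 (admits r₁ (hole j true))
    𝟙-∨ : ∀ x y → 𝟙 (x ∨ y) ≤ 𝟙 x + 𝟙 y
    𝟙-∨ true y = s≤s z≤n
    𝟙-∨ false y = ≤-refl
    regroup : ∀ a b c d e f → a + b + c + d + (e + f) ≡ (a + b + e) + (c + d + f)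
    regroup = solve-∀

  big? : (D : Conj (suc ℓ′)) → Dec (m ∸ 2 ≤ #mentionedPairs D)
  big? D = m ∸ 2 ≤? #mentionedPairs D

  survivors : Conj (suc ℓ′) → ℕ
  survivors D = product λ j → #choices (pairAdmits j D)

  survivors-big : ∀ D → m ∸ 2 ≤ #mentionedPairs D → survivors D * 4 ^ (m ∸ 2) ≤ 3 ^ (m ∸ 2) * 4 ^ m
  survivors-big D q₀≤ = threshold-bound (survivors D) m q₀≤
    (product-bound m (λ j → #choices (pairAdmits j D)) (pairMentioned D) (pair-choices-bound D))

  killing-choice : (Ds : List (Conj (suc ℓ′))) → length Ds * 3 ^ (m ∸ 2) < 4 ^ (m ∸ 2) →
    Σ (Fin m → Bool × Bool) λ x → All (λ D → ∃ λ j → pairAdmits j D (x j) ≡ false) (filter big? Ds)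
  killing-choice Ds few = union-bound m pairAdmits Big (*-cancelʳ-< (4 ^ q₀) (listSum (L.map survivors Big)) (4 ^ m) (begin-strict
    listSum (L.map survivors Big) * 4 ^ q₀
      ≤⟨ listSum-bound survivors (4 ^ q₀) (3 ^ q₀ * 4 ^ m) Big (All.map (λ {D} → survivors-big D) (all-filter big? Ds)) ⟩
    length Big * (3 ^ q₀ * 4 ^ m)    ≡⟨ *-assoc (length Big) (3 ^ q₀) (4 ^ m) ⟨
    length Big * 3 ^ q₀ * 4 ^ m      <⟨ *-monoˡ-< (4 ^ m) {{m^n≢0 4 m}} (≤-<-trans (*-monoˡ-≤ (3 ^ q₀) (length-filter big? Ds)) few) ⟩
    4 ^ q₀ * 4 ^ m                   ≡⟨ *-comm (4 ^ q₀) (4 ^ m) ⟩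
    4 ^ m * 4 ^ q₀                   ∎))
    where
    open ≤-Reasoning
    q₀ = m ∸ 2
    Big = filter big? Ds

module Restriction (ℓ′ : ℕ) (x : Fin (2 ^ ℓ′) → Bool × Bool) where

  open Pairing ℓ′

  matchedPigeon matchedHole : Fin m → Bool
  matchedPigeon = proj₁ ∘ x
  matchedHole = proj₂ ∘ x

  select : Fin m → Bool → Maybe (Hole (suc ℓ′))
  select j c = if c == matchedPigeon j then just (hole j (matchedHole j)) else nothing

  σ : Pigeon (suc ℓ′) → Maybe (Hole (suc ℓ′))
  σ zero = nothing
  σ (suc p) = [ (λ j → select j false) , (λ y → select (fromRight y) true) ]′ (splitAt m p)

  available : Fin m → Bool → Bool
  available j b = not (b == matchedHole j)

  av : Pred (2 ^ suc ℓ′)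
  av h = [ (λ j → available j false) , (λ y → available (opposite (fromRight y)) true) ]′ (splitAt m h)

  σ-pigeon : ∀ j c → σ (pigeon j c) ≡ select j c
  σ-pigeon j false rewrite FP.splitAt-↑ˡ m j (m + 0) = refl
  σ-pigeon j true rewrite FP.splitAt-↑ʳ m (m + 0) (toRight j) = cong (λ i → select i true) (fromRight∘toRight j)

  av-hole : ∀ j b → av (hole j b) ≡ available j b
  av-hole j false rewrite FP.splitAt-↑ˡ m j (m + 0) = refl
  av-hole j true rewrite FP.splitAt-↑ʳ m (m + 0) (toRight (opposite j)) | fromRight∘toRight (opposite j)
    | FP.opposite-involutive j = refl

  decode : ∀ p h → σ p ≡ just h → Σ (Fin m) λ j → p ≡ pigeon j (matchedPigeon j) × h ≡ hole j (matchedHole j)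
  decode zero h ()
  decode (suc p) h σp with splitAt m p in split
  ... | inj₁ j with false == matchedPigeon j in c
  ...   | true = j , trans (cong suc (sym (FP.splitAt⁻¹-↑ˡ split))) (cong (pigeon j) (==⇒≡ {false} c)) , sym (just-injective σp)
  decode (suc p) h () | inj₁ j | false
  decode (suc p) h σp | inj₂ y with true == matchedPigeon (fromRight y) in c
  ...   | true = fromRight y , trans (cong suc (trans (sym (FP.splitAt⁻¹-↑ʳ split)) (cong (m ↑ʳ_) (sym (toRight∘fromRight y)))))
                                     (cong (pigeon (fromRight y)) (==⇒≡ {true} c)) , sym (just-injective σp)
  decode (suc p) h () | inj₂ y | false

  σ-injective : ∀ p p′ h → σ p ≡ just h → σ p′ ≡ just h → p ≡ p′
  σ-injective p p′ h σp σp′ with decode p h σp | decode p′ h σp′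
  ... | j , p≡ , h≡ | j′ , p′≡ , h≡′ with hole-injective j j′ (matchedHole j) (matchedHole j′) (trans (sym h≡) h≡′)
  ... | refl = trans p≡ (sym p′≡)

  σ-unavailable : ∀ p h → σ p ≡ just h → av h ≡ false
  σ-unavailable p h σp with decode p h σp
  ... | j , _ , refl rewrite av-hole j (matchedHole j) | ==-refl (matchedHole j) = refl

  ∣av∣≡m : ∣ av ∣ ≡ m
  ∣av∣≡m = begin
    sum (𝟙 ∘ av)
      ≡⟨ sum-↑ m (𝟙 ∘ av) ⟩
    sum {m} (𝟙 ∘ av ∘ (_↑ˡ (m + 0))) + sum {m + 0} (𝟙 ∘ av ∘ (m ↑ʳ_))
      ≡⟨ cong₂ _+_ (sum-cong-≗ (λ j → cong 𝟙 (av-hole j false))) (sum-cast (sym m+0≡m) (𝟙 ∘ av ∘ (m ↑ʳ_))) ⟩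
    sum (λ j → 𝟙 (available j false)) + sum (λ j → 𝟙 (av (m ↑ʳ toRight j)))
      ≡⟨ cong (sum (λ j → 𝟙 (available j false)) +_) (sum-cong-≗ right-half) ⟩
    sum (λ j → 𝟙 (available j false)) + sum (λ j → 𝟙 (available (opposite j) true))
      ≡⟨ cong (sum (λ j → 𝟙 (available j false)) +_) (sum-opposite (λ j → 𝟙 (available j true))) ⟩
    sum (λ j → 𝟙 (available j false)) + sum (λ j → 𝟙 (available j true))
      ≡⟨ ∑-distrib-+ (λ j → 𝟙 (available j false)) (λ j → 𝟙 (available j true)) ⟨
    sum (λ j → 𝟙 (available j false) + 𝟙 (available j true))
      ≡⟨ sum-cong-≗ (λ j → one-available (matchedHole j)) ⟩
    sum {m} (λ _ → 1)
      ≡⟨ sum-ones m ⟩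
    m ∎
    where
    open ≡-Reasoning
    right-half : ∀ j → 𝟙 (av (m ↑ʳ toRight j)) ≡ 𝟙 (available (opposite j) true)
    right-half j = cong 𝟙 (trans (cong (λ i → av (m ↑ʳ toRight i)) (sym (FP.opposite-involutive j))) (av-hole (opposite j) true))
    one-available : ∀ b → 𝟙 (not (false == b)) + 𝟙 (not (true == b)) ≡ 1
    one-available true = refl
    one-available false = refl

  open Solution {ℓ′} σ av σ-injective σ-unavailable public

  pair-size : ∀ D j → length (slotPreds (σ (pigeon j false)) (row D (pigeon j false)))
                      + length (slotPreds (σ (pigeon j true)) (row D (pigeon j true))) ≤ 𝟙 (pairMentioned D j)
  pair-size D j rewrite σ-pigeon j false | σ-pigeon j true with matchedPigeon j
  ... | false = subst (_≤ 𝟙 (pairMentioned D j)) (sym (length-free (row D (pigeon j true))))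
                  (𝟙-∨ʳ (mentioned (row D (pigeon j false))) _)
  ... | true = subst (_≤ 𝟙 (pairMentioned D j)) (sym (trans (+-identityʳ _) (length-free (row D (pigeon j false)))))
                  (𝟙-∨ˡ _ (mentioned (row D (pigeon j true))))

  size-bound : ∀ D → size D ≤ 1 + #mentionedPairs D
  size-bound D = begin
    size D                                                       ≡⟨ size≡sum D ⟩
    len zero + sum (len ∘ suc)
      ≤⟨ +-monoˡ-≤ (sum (len ∘ suc)) (length-slotPreds≤1 (σ zero) (row D zero)) ⟩
    1 + sum (len ∘ suc)                                          ≡⟨ cong (1 +_) (sum-↑ m (len ∘ suc)) ⟩
    1 + (sum (λ j → len (pigeon j false)) + sum (len ∘ suc ∘ (m ↑ʳ_)))
      ≡⟨ cong (λ n → 1 + (sum (λ j → len (pigeon j false)) + n)) (sum-cast (sym m+0≡m) (len ∘ suc ∘ (m ↑ʳ_))) ⟩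
    1 + (sum (λ j → len (pigeon j false)) + sum (λ j → len (pigeon j true)))
      ≡⟨ cong (1 +_) (∑-distrib-+ (λ j → len (pigeon j false)) (λ j → len (pigeon j true))) ⟨
    1 + sum (λ j → len (pigeon j false) + len (pigeon j true))   ≤⟨ +-monoʳ-≤ 1 (sum-mono-≤ (pair-size D)) ⟩
    1 + #mentionedPairs D                                        ∎
    where
    open ≤-Reasoning
    len : Pigeon (suc ℓ′) → ℕ
    len p = length (slotPreds (σ p) (row D p))

  kill : ∀ D j → pairAdmits j D (x j) ≡ false → matchedWeight D ≡ 0
  kill D j dead = product-zero (λ p → slotWeight (σ p) (row D p)) (pigeon j (matchedPigeon j))
    (trans (cong (λ s → slotWeight s (row D (pigeon j (matchedPigeon j)))) (trans (σ-pigeon j (matchedPigeon j)) select-self))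
           (cong 𝟙 dead))
    where
    select-self : select j (matchedPigeon j) ≡ just (hole j (matchedHole j))
    select-self rewrite ==-refl (matchedPigeon j) = refl

  good-if-killed : 2 ≤ m → ∀ D → (m ∸ 2 ≤ #mentionedPairs D → ∃ λ j → pairAdmits j D (x j) ≡ false) → Good D
  good-if-killed 2≤m D killed = by-size (big? D)
    where
    by-size : Dec (m ∸ 2 ≤ #mentionedPairs D) → Good D
    by-size (yes q₀≤) = inj₁ (kill D (proj₁ (killed q₀≤)) (proj₂ (killed q₀≤)))
    by-size (no q₀≰) = inj₂ (begin
      2 + size D                   ≤⟨ +-monoʳ-≤ 2 (size-bound D) ⟩
      2 + (1 + #mentionedPairs D)  ≤⟨ +-monoʳ-≤ 2 (≰⇒> q₀≰) ⟩
      2 + (m ∸ 2)                  ≡⟨ m+[n∸m]≡n 2≤m ⟩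
      m                            ≡⟨ ∣av∣≡m ⟨
      ∣ av ∣                       ∎)
      where open ≤-Reasoning

no-restricted-refutation : ∀ ℓ′ (R : List (Constraint (suc ℓ′))) → Refutation R → 2 ≤ 2 ^ ℓ′ →
  numTerms R * 3 ^ (2 ^ ℓ′ ∸ 2) < 4 ^ (2 ^ ℓ′ ∸ 2) → ⊥
no-restricted-refutation ℓ′ R refutes 2≤m few = killed⇒⊥ (proj₁ killing) (proj₂ killing)
  where
  open Pairing ℓ′
  Ds = deduplicate _≟C_ (concatMap terms R)
  killing = killing-choice Ds few
  killed⇒⊥ : (x : Fin m → Bool × Bool) → All (λ D → ∃ λ j → pairAdmits j D (x j) ≡ false) (filter big? Ds) → ⊥
  killed⇒⊥ x kills = refutes (solution R λ c c∈R D D∈c → good-if-killed 2≤m D λ q₀≤ →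
    All.lookup kills (∈-filter⁺ big? (∈-deduplicate⁺ _≟C_ (∈-concatMap⁺ terms (Any.map (λ { refl → D∈c }) c∈R))) q₀≤))
    where open Restriction ℓ′ x

refutation-has-terms : ∀ {ℓ} (R : List (Constraint ℓ)) → Refutation R → 1 ≤ numTerms R
refutation-has-terms [] refutes = ⊥-elim (refutes ((λ _ → ℚ.1ℚ) , refl , []))
refutation-has-terms (clauseC _ _ _ _ _ ∷ R) _ = s≤s z≤n
refutation-has-terms (complC _ _ _ ∷ R) _ = s≤s z≤n
refutation-has-terms (boundC _ _ ∷ R) _ = s≤s z≤n

small-refutation-size : ∀ ℓ t → 1 ≤ t → 6 ^ (2 ^ ℓ) ≤ 2 ^ 16 * 5 ^ (2 ^ ℓ) → ¬ ((t + 1) ^ 16 * 5 ^ (2 ^ ℓ) < 6 ^ (2 ^ ℓ))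
small-refutation-size ℓ t 1≤t 6^n≤ too-small = <⇒≱ too-small
  (≤-trans 6^n≤ (*-monoˡ-≤ (5 ^ (2 ^ ℓ)) (^-monoˡ-≤ 16 (+-monoˡ-≤ 1 1≤t))))

refutation-size : ∀ ℓ (R : List (Constraint ℓ)) → Refutation R → ¬ ((numTerms R + 1) ^ 16 * 5 ^ (2 ^ ℓ) < 6 ^ (2 ^ ℓ))
refutation-size 0 R refutes = small-refutation-size 0 (numTerms R) (refutation-has-terms R refutes) (≤ᵇ⇒≤ _ _ _)
refutation-size 1 R refutes = small-refutation-size 1 (numTerms R) (refutation-has-terms R refutes) (≤ᵇ⇒≤ _ _ _)
refutation-size 2 R refutes = small-refutation-size 2 (numTerms R) (refutation-has-terms R refutes) (≤ᵇ⇒≤ _ _ _)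
refutation-size 3 R refutes = small-refutation-size 3 (numTerms R) (refutation-has-terms R refutes) (≤ᵇ⇒≤ _ _ _)
refutation-size (suc (suc (suc (suc w)))) R refutes too-small =
  no-restricted-refutation (3 + w) R refutes 2≤m
    (subst (λ m → numTerms R * 3 ^ (m ∸ 2) < 4 ^ (m ∸ 2)) (sym (m≡8u u))
      (restriction-estimate u (numTerms R) 1≤u (subst (λ n → (numTerms R + 1) ^ 16 * 5 ^ n < 6 ^ n) (n≡16u u) too-small)))
  where
  u = 2 ^ w
  1≤u : 1 ≤ u
  1≤u = m^n>0 2 w
  n≡16u : ∀ u → 2 * (2 * (2 * (2 * u))) ≡ 16 * u
  n≡16u = solve-∀
  m≡8u : ∀ u → 2 * (2 * (2 * u)) ≡ 8 * u
  m≡8u = solve-∀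
  2≤m : 2 ≤ 2 ^ (3 + w)
  2≤m = subst (2 ≤_) (sym (m≡8u u)) (≤-trans (s≤s (s≤s z≤n)) (*-monoʳ-≤ 8 1≤u))

theorem4 : (ℓ : ℕ) (R : List (Constraint ℓ)) → Refutation R →
    6 ^ (2 ^ ℓ) ≤ (numTerms R + 1) ^ 16 * 5 ^ (2 ^ ℓ)
theorem4 ℓ R refutes = ≮⇒≥ (refutation-size ℓ R refutes)
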